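{- Let $P,Q$ be integers, $\Delta=P^2-4Q$, and let $n$ be an integer with $\gcd(n,2\Delta Q)=1$. Let $Q'$ be an integer with $Q'\equiv Q^{ -1}\pmod n$. If $n$ is a strong Frobenius pseudoprime with respect to $X^2+(2-P^2Q')X+1$, then $n$ is a strong Lucas pseudoprime with parameters $(P,Q)$.
   Context: Lucas sequences: $U_0=0$, $U_1=1$, $U_k=PU_{k-1}-QU_{k-2}$; $V_0=2$, $V_1=P$, $V_k=PV_{k-1}-QV_{k-2}$. A strong Lucas pseudoprime with parameters $(P,Q)$ is a composite $n$ with $\gcd(n,2Q\Delta)=1$, written $n=2^rs+\left(\frac{\Delta}{n}\right)$ with $s$ odd (Jacobi symbol), such that either $U_s\equiv 0\pmod n$ or $V_{2^ts}\equiv 0\pmod n$ for some $t$ with $0\le t<r$. For monic polynomials $g_1,g_2$ over a commutative ring $R$ with identity, a monic $h\in R[x]$ is $\operatorname{gcmd}(g_1,g_2)$ if the ideal generated by $g_1,g_2$ equals the ideal generated by $h$ (it may fail to exist). Let $f(x)\in\mathbb{Z}[x]$ be monic of degree $d$ with discriminant $\Delta_f$. An odd integer $n>1$ is a Frobenius probable prime with respect to $f$ if $\gcd(n,f(0)\Delta_f)=1$ and, with all computations in $(\mathbb{Z}/n\mathbb{Z})[x]$: (Factorization) setting $f_0=f\bmod n$ and, for $1\le i\le d$, $F_i=\operatorname{gcmd}(x^{n^i}-x,f_{i-1})$ and $f_i=f_{i-1}/F_i$, all these gcmds exist and $f_d=1$; (Frobenius) for $2\le i\le d$, $F_i(x^n)\equiv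 0\pmod{F_i(x)}$; (Jacobi) with $S=\sum_{2\mid i}\deg(F_i)/i$, $(-1)^S=\left(\frac{\Delta_f}{n}\right)$. $n$ is a strong Frobenius probable prime with respect to $f$ if moreover (Square Root Step) for each $1\le i\le d$, writing $n^i-1=2^rs$ with $s$ odd, the polynomials $F_{i,0}=\operatorname{gcmd}(F_i,x^s-1)$ and $F_{i,j}=\operatorname{gcmd}(F_i,x^{2^{j-1}s}+1)$ ($1\le j\le r$) all exist, $F_i=\prod_{j=0}^rF_{i,j}$, and each $\deg F_{i,j}$ is a multiple of $i$. A strong Frobenius pseudoprime is a composite strong Frobenius probable prime. -}

module Defs where

open import Data.Nat as ℕ using (ℕ; zero; suc; _<_; _≤_)
open import Data.Nat.Primality using (Prime; Composite)
open import Data.Nat.Coprimality using (Coprime)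
import Data.Nat.Divisibility as ℕD
open import Data.Integer as ℤ using (ℤ; +_; -[1+_]; _+_; _-_; _*_; -_; ∣_∣)
open import Data.Integer.Divisibility using (_∣_)
open import Data.List using (List; []; _∷_; _++_; replicate; map; length; last)
open import Data.List.Relation.Unary.All using (All)
open import Data.Maybe using (just)
open import Data.Product using (Σ; ∃; ∃-syntax; _×_)
open import Relation.Binary.PropositionalEquality using (_≡_)
open import Relation.Nullary using (¬_)
open import Data.Bool using (Bool; true; false; if_then_else_)
open import Data.Nat.DivMod using (_/_)

U : ℤ → ℤ → ℕ → ℤ
U P Q zero = + 0
U P Q (suc zero) = + 1
U P Q (suc (suc k)) = P * U P Q (suc k) - Q * U P Q k

V : ℤ → ℤ → ℕ → ℤ
V P Q zero = + 2
V P Q (suc zero) = P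
V P Q (suc (suc k)) = P * V P Q (suc k) - Q * V P Q k

OddN : ℕ → Set
OddN s = ¬ (2 ℕD.∣ s)

-- Legendre and Jacobi symbols, as (functional) relations.
-- LegendreRel a p l : for an odd prime p, l = (a/p).
data LegendreRel (a : ℤ) (p : ℕ) : ℤ → Set where
  divides    : (+ p) ∣ a → LegendreRel a p (+ 0)
  residue    : ¬ ((+ p) ∣ a) → (∃[ x ] ((+ p) ∣ (x * x - a))) → LegendreRel a p (+ 1)
  nonresidue : ¬ (∃[ x ] ((+ p) ∣ (x * x - a))) → LegendreRel a p (- (+ 1))

data JacobiRel (a : ℤ) : ℕ → ℤ → Set where
  one  : JacobiRel a 1 (+ 1)
  step : ∀ {p m l j} → Prime p → LegendreRel a p l → JacobiRel a m j →
         JacobiRel a (p ℕ.* m) (l * j)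

StrongLucasPSP : ℤ → ℤ → ℕ → Set
StrongLucasPSP P Q n =
  Composite n ×
  Coprime n ∣ + 2 * Q * (P * P - + 4 * Q) ∣ ×
  ∃[ ε ] JacobiRel (P * P - + 4 * Q) n ε ×
   ∃[ r ] ∃[ s ] (OddN s × (+ n ≡ + (2 ℕ.^ r ℕ.* s) + ε) ×
     ((+ n ∣ U P Q s) ⊎' (∃[ t ] (t < r × (+ n ∣ V P Q (2 ℕ.^ t ℕ.* s))))))
  where
  open import Data.Sum using () renaming (_⊎_ to _⊎'_)

-- Polynomials over ℤ (coefficient lists, lowest degree first),
-- considered modulo n, i.e. as elements of (ℤ/nℤ)[x].

Poly : Set
Poly = List ℤ

infixl 6 _+ᴾ_ _-ᴾ_
infixl 7 _*ᴾ_

_+ᴾ_ : Poly → Poly → Poly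
[] +ᴾ q = q
(a ∷ p) +ᴾ [] = a ∷ p
(a ∷ p) +ᴾ (b ∷ q) = (a + b) ∷ (p +ᴾ q)

scaleᴾ : ℤ → Poly → Poly
scaleᴾ c = map (c *_)

_-ᴾ_ : Poly → Poly → Poly
p -ᴾ q = p +ᴾ scaleᴾ (- (+ 1)) q

_*ᴾ_ : Poly → Poly → Poly
[] *ᴾ q = []
(a ∷ p) *ᴾ q = scaleᴾ a q +ᴾ (+ 0 ∷ (p *ᴾ q))

constᴾ : ℤ → Poly
constᴾ c = c ∷ []

monoᴾ : ℕ → Poly
monoᴾ k = replicate k (+ 0) ++ (+ 1 ∷ [])

composeᴾ : Poly → Poly → Poly
composeᴾ [] q = []
composeᴾ (a ∷ p) q = constᴾ a +ᴾ q *ᴾ composeᴾ p q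

_≈[_]_ : Poly → ℕ → Poly → Set
p ≈[ n ] q = All (λ c → (+ n) ∣ c) (p -ᴾ q)

-- p is (represented as) a monic polynomial over ℤ/nℤ: its last
-- coefficient is ≡ 1 (mod n); its degree is then length ∸ 1.
Monic : ℕ → Poly → Set
Monic n p = ∃[ c ] (last p ≡ just c × (+ n) ∣ (c - + 1))

deg : Poly → ℕ
deg p = length p ℕ.∸ 1

-- h = gcmd(g₁, g₂) over ℤ/nℤ: h monic and the ideals (g₁, g₂) and (h)
-- of (ℤ/nℤ)[x] coincide.
IsGcmd : ℕ → Poly → Poly → Poly → Set
IsGcmd n g₁ g₂ h =
  Monic n h ×
  (∃[ a ] ∃[ b ] ((a *ᴾ g₁ +ᴾ b *ᴾ g₂) ≈[ n ] h)) ×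
  (∃[ c ] (g₁ ≈[ n ] (c *ᴾ h))) ×
  (∃[ c ] (g₂ ≈[ n ] (c *ᴾ h)))

prodUpTo : (ℕ → Poly) → ℕ → Poly
prodUpTo G zero = G zero
prodUpTo G (suc r) = prodUpTo G r *ᴾ G (suc r)

sumFrom1 : (ℕ → ℕ) → ℕ → ℕ
sumFrom1 g zero = zero
sumFrom1 g (suc d) = sumFrom1 g d ℕ.+ g (suc d)

evenN : ℕ → Bool
evenN zero = true
evenN (suc zero) = false
evenN (suc (suc k)) = evenN k

evenTerm : (ℕ → Poly) → ℕ → ℕ
evenTerm F zero = zero
evenTerm F (suc k) = if evenN (suc k) then deg (F (suc k)) / suc k else zero

-- (Strong) Frobenius probable primes w.r.t. a monic f of degree d with
-- discriminant Δf (Δf is supplied; see discQuad for the quadratic case).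

FrobeniusData : ℕ → ℕ → Poly → ℤ → (ℕ → Poly) → Set
FrobeniusData n d f Δf F =
  (Σ (ℕ → Poly) λ fs → ((fs 0 ≈[ n ] f) ×
    (∀ i → 1 ≤ i → i ≤ d →
       IsGcmd n (monoᴾ (n ℕ.^ i) -ᴾ monoᴾ 1) (fs (i ℕ.∸ 1)) (F i) ×
       Monic n (fs i) × (fs (i ℕ.∸ 1) ≈[ n ] (F i *ᴾ fs i))) ×
    (fs d ≈[ n ] constᴾ (+ 1)))) ×
  (∀ i → 2 ≤ i → i ≤ d →
     ∃[ c ] (composeᴾ (F i) (monoᴾ n) ≈[ n ] (c *ᴾ F i))) ×
  (∃[ j ] (JacobiRel Δf n j ×
     (- (+ 1)) ℤ.^ sumFrom1 (evenTerm F) d ≡ j))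

SquareRootStep : ℕ → ℕ → (ℕ → Poly) → Set
SquareRootStep n d F =
  ∀ i → 1 ≤ i → i ≤ d →
    ∃[ r ] ∃[ s ] (OddN s × (n ℕ.^ i ℕ.∸ 1 ≡ 2 ℕ.^ r ℕ.* s) ×
      Σ (ℕ → Poly) λ G → (IsGcmd n (F i) (monoᴾ s -ᴾ constᴾ (+ 1)) (G 0) ×
        (∀ j → 1 ≤ j → j ≤ r →
           IsGcmd n (F i) (monoᴾ (2 ℕ.^ (j ℕ.∸ 1) ℕ.* s) +ᴾ constᴾ (+ 1)) (G j)) ×
        (F i ≈[ n ] prodUpTo G r) ×
        (∀ j → j ≤ r → i ℕD.∣ deg (G j))))

const0 : Poly → ℤ
const0 [] = + 0
const0 (a ∷ _) = a

StrongFrobeniusPP : ℕ → ℕ → Poly → ℤ → Set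
StrongFrobeniusPP n d f Δf =
  OddN n × 1 < n × Coprime n ∣ const0 f * Δf ∣ ×
  ∃[ F ] (FrobeniusData n d f Δf F × SquareRootStep n d F)

quad : ℤ → ℤ → Poly
quad b c = c ∷ b ∷ + 1 ∷ []

discQuad : ℤ → ℤ → ℤ
discQuad b c = b * b - + 4 * c

StrongFrobeniusPSPQuad : ℕ → ℤ → ℤ → Set
StrongFrobeniusPSPQuad n b c =
  Composite n × StrongFrobeniusPP n 2 (quad b c) (discQuad b c)

{-# OPTIONS --safe #-}
-- Put B = 2 - P²Q′ and f = x² + B x + 1, and compute in R = (ℤ/nℤ)[X]/(f). With
-- P P⁻¹ ≡ 1, the elements β = P⁻¹ Q (1 - B - X) and α = β X satisfy α + β = P and α β = Q, so
-- U_k (α - β) = αᵏ - βᵏ and V_k = αᵏ + βᵏ; as α / β = X, Xˢ = 1 gives n ∣ U_s and Xᵉ = -1 gives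
-- n ∣ V_e. The Frobenius data factors f = F₁ F₂ with deg F₁ + deg F₂ = 2. If f = F₁ (Jacobi
-- symbol 1), the square root step for n - 1 = 2ʳ s makes X a root of xˢ - 1 or of some
-- x^(2ᵗ s) + 1 with t < r: f cannot split into linear factors dividing two different such
-- factors, because the roots of f are inverse to each other. If f = F₂ (Jacobi symbol -1), the
-- gcmd and Frobenius steps make Xⁿ the other root X⁻¹ of f, so X^(n+1) = 1, and the square root
-- step for n² - 1 = (n + 1)(n - 1) yields the same conclusion for the odd part of n + 1.
-- Finally deg F₂ = 1 is impossible, as the square root step makes deg F₂ even.
module Submission where

open import Level using (0ℓ)
open import Data.Empty using (⊥-elim)
open import Data.Product using (_×_; _,_; proj₁; proj₂; ∃-syntax)
open import Data.Sum using (_⊎_; inj₁; inj₂; [_,_]′)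
open import Data.Nat as ℕ using (ℕ; zero; suc; z≤n; s≤s)
open import Data.Integer as ℤ using (ℤ; +_)
import Data.Integer.Divisibility.Signed as Signed
import Data.Integer.Divisibility as Unsigned
open import Data.List using ([]; _∷_)
open import Algebra.Bundles using (CommutativeRing)
open import Algebra.Solver.Ring.AlmostCommutativeRing
  using (fromCommutativeRing; _-Raw-AlmostCommutative⟶_)
open import Defs

module Congruence (n : ℕ) where
  import Data.Nat.Properties as ℕₚ
  import Data.Nat.Divisibility as ℕᵈ
  open import Data.Integer using (_+_; _-_; _*_; -_)
  import Data.Integer.Properties as ℤₚ
  open import Data.Integer.Divisibility.Signed
  open import Data.Integer.Tactic.RingSolver using (solve-∀)
  open import Relation.Binary.PropositionalEquality using (_≡_; refl; sym; subst)
  open import Relation.Nullary using (¬_)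

  infix 4 _≡ₙ_
  record _≡ₙ_ (a b : ℤ) : Set where
    constructor mod-n
    field n∣a-b : + n ∣ a - b
  open _≡ₙ_ public

  private
    sym-diff : ∀ a b → - (a - b) ≡ b - a
    sym-diff = solve-∀
    trans-diff : ∀ a b c → (a - b) + (b - c) ≡ a - c
    trans-diff = solve-∀
    +-diff : ∀ a b c d → (a - b) + (c - d) ≡ (a + c) - (b + d)
    +-diff = solve-∀
    *-diff : ∀ a b c d → (a - b) * c + b * (c - d) ≡ a * c - b * d
    *-diff = solve-∀
    neg-diff : ∀ a b → - (a - b) ≡ - a - - b
    neg-diff = solve-∀

    ∣-resp : ∀ {x y} → x ≡ y → + n ∣ x → + n ∣ y
    ∣-resp = subst (+ n ∣_)

  n∣⇒≡ₙ0 : ∀ {a} → + n ∣ a → a ≡ₙ + 0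
  n∣⇒≡ₙ0 {a} n∣a = mod-n (∣-resp (sym (ℤₚ.+-identityʳ a)) n∣a)

  ≡⇒≡ₙ : ∀ {a b} → a ≡ b → a ≡ₙ b
  ≡⇒≡ₙ {a} refl = mod-n (∣-resp (sym (ℤₚ.+-inverseʳ a)) (divides (+ 0) refl))

  ≡ₙ-refl : ∀ {a} → a ≡ₙ a
  ≡ₙ-refl = ≡⇒≡ₙ refl

  ≡ₙ-sym : ∀ {a b} → a ≡ₙ b → b ≡ₙ a
  ≡ₙ-sym {a} {b} (mod-n d) = mod-n (∣-resp (sym-diff a b) (∣m⇒∣-m d))

  ≡ₙ-trans : ∀ {a b c} → a ≡ₙ b → b ≡ₙ c → a ≡ₙ c
  ≡ₙ-trans {a} {b} {c} (mod-n d) (mod-n e) =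
    mod-n (∣-resp (trans-diff a b c) (∣m∣n⇒∣m+n d e))

  +-congₙ : ∀ {a b c d} → a ≡ₙ b → c ≡ₙ d → a + c ≡ₙ b + d
  +-congₙ {a} {b} {c} {d} (mod-n p) (mod-n q) =
    mod-n (∣-resp (+-diff a b c d) (∣m∣n⇒∣m+n p q))

  *-congₙ : ∀ {a b c d} → a ≡ₙ b → c ≡ₙ d → a * c ≡ₙ b * d
  *-congₙ {a} {b} {c} {d} (mod-n p) (mod-n q) =
    mod-n (∣-resp (*-diff a b c d) (∣m∣n⇒∣m+n (∣m⇒∣m*n c p) (∣n⇒∣m*n b q)))

  -‿congₙ : ∀ {a b} → a ≡ₙ b → - a ≡ₙ - b
  -‿congₙ {a} {b} (mod-n p) = mod-n (∣-resp (neg-diff a b) (∣m⇒∣-m p))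

  -congₙ : ∀ {a b c d} → a ≡ₙ b → c ≡ₙ d → a - c ≡ₙ b - d
  -congₙ p q = +-congₙ p (-‿congₙ q)

  0≢ₙ1 : 1 ℕ.< n → ¬ (+ 0 ≡ₙ + 1)
  0≢ₙ1 1<n (mod-n n∣-1) with ℕᵈ.∣1⇒≡1 (∣⇒∣ᵤ n∣-1)
  ... | refl = ℕₚ.<-irrefl refl 1<n

module QuadraticQuotient (n : ℕ) (B : ℤ) where
  open import Data.Integer using (_+_; _-_; _*_; -_)
  open import Data.Integer.Divisibility.Signed using (_∣_)
  open import Data.Integer.Tactic.RingSolver using (solve-∀)
  import Data.Integer.Properties as ℤₚ
  open import Relation.Binary.PropositionalEquality using (_≡_; refl; subst)
  open import Relation.Binary.Structures using (IsEquivalence)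
  open import Algebra.Structures using (IsCommutativeRing)
  open Congruence n

  -- (a , b) represents a + b X in (ℤ/nℤ)[X]/(X² + B X + 1), where X² = - B X - 1.
  Element : Set
  Element = ℤ × ℤ

  infix 4 _≈_
  record _≈_ (u v : Element) : Set where
    constructor _,_
    field
      ≈-fst : proj₁ u ≡ₙ proj₁ v
      ≈-snd : proj₂ u ≡ₙ proj₂ v

  infixl 6 _⊕_
  infixl 7 _⊛_

  _⊕_ : Element → Element → Element
  (a , b) ⊕ (c , d) = (a + c , b + d)

  ⊝_ : Element → Element
  ⊝ (a , b) = (- a , - b)

  _⊛_ : Element → Element → Element
  (a , b) ⊛ (c , d) = (a * c - b * d , a * d + b * c - B * (b * d))

  ι : ℤ → Element
  ι a = (a , + 0)

  X : Element
  X = (+ 0 , + 1)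

  private
    componentwise : ∀ {a b c d} → a ≡ c → b ≡ d → (a , b) ≈ (c , d)
    componentwise p q = ≡⇒≡ₙ p , ≡⇒≡ₙ q

    +-assoc : ∀ a b c → (a + b) + c ≡ a + (b + c)
    +-assoc = solve-∀
    +-identityˡ : ∀ a → + 0 + a ≡ a
    +-identityˡ = solve-∀
    +-identityʳ : ∀ a → a + + 0 ≡ a
    +-identityʳ = solve-∀
    +-inverseˡ : ∀ a → - a + a ≡ + 0
    +-inverseˡ = solve-∀
    +-inverseʳ : ∀ a → a + - a ≡ + 0
    +-inverseʳ = solve-∀
    +-comm : ∀ a b → a + b ≡ b + a
    +-comm = solve-∀
    *-assoc₁ : ∀ B a b c d e f → (a * c - b * d) * e - (a * d + b * c - B * (b * d)) * f
                             ≡ a * (c * e - d * f) - b * (c * f + d * e - B * (d * f))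
    *-assoc₁ = solve-∀
    *-assoc₂ : ∀ B a b c d e f →
      (a * c - b * d) * f + (a * d + b * c - B * (b * d)) * e - B * ((a * d + b * c - B * (b * d)) * f)
      ≡ a * (c * f + d * e - B * (d * f)) + b * (c * e - d * f) - B * (b * (c * f + d * e - B * (d * f)))
    *-assoc₂ = solve-∀
    *-identityˡ₁ : ∀ a b → + 1 * a - + 0 * b ≡ a
    *-identityˡ₁ = solve-∀
    *-identityˡ₂ : ∀ B a b → + 1 * b + + 0 * a - B * (+ 0 * b) ≡ b
    *-identityˡ₂ = solve-∀
    *-identityʳ₁ : ∀ a b → a * + 1 - b * + 0 ≡ a
    *-identityʳ₁ = solve-∀
    *-identityʳ₂ : ∀ B a b → a * + 0 + b * + 1 - B * (b * + 0) ≡ b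
    *-identityʳ₂ = solve-∀
    *-comm₁ : ∀ a b c d → a * c - b * d ≡ c * a - d * b
    *-comm₁ = solve-∀
    *-comm₂ : ∀ B a b c d → a * d + b * c - B * (b * d) ≡ c * b + d * a - B * (d * b)
    *-comm₂ = solve-∀
    distribˡ₁ : ∀ a b c d e f → a * (c + e) - b * (d + f) ≡ (a * c - b * d) + (a * e - b * f)
    distribˡ₁ = solve-∀
    distribˡ₂ : ∀ B a b c d e f → a * (d + f) + b * (c + e) - B * (b * (d + f))
                              ≡ (a * d + b * c - B * (b * d)) + (a * f + b * e - B * (b * f))
    distribˡ₂ = solve-∀
    distribʳ₁ : ∀ a b c d e f → (c + e) * a - (d + f) * b ≡ (c * a - d * b) + (e * a - f * b)
    distribʳ₁ = solve-∀
    distribʳ₂ : ∀ B a b c d e f → (c + e) * b + (d + f) * a - B * ((d + f) * b)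
                              ≡ (c * b + d * a - B * (d * b)) + (e * b + f * a - B * (f * b))
    distribʳ₂ = solve-∀
    ι-*₁ : ∀ a c → a * c ≡ a * c - + 0 * + 0
    ι-*₁ = solve-∀
    ι-*₂ : ∀ B a c → + 0 ≡ a * + 0 + + 0 * c - B * (+ 0 * + 0)
    ι-*₂ = solve-∀
    X-root₁ : ∀ B → + 0 * + 0 - + 1 * + 1 + (B * + 0 - + 0 * + 1) + + 1 ≡ + 0
    X-root₁ = solve-∀
    X-root₂ : ∀ B → + 0 * + 1 + + 1 * + 0 - B * (+ 1 * + 1)
                    + (B * + 1 + + 0 * + 0 - B * (+ 0 * + 1)) + + 0 ≡ + 0
    X-root₂ = solve-∀

  ≈-isEquivalence : IsEquivalence _≈_
  ≈-isEquivalence = record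
    { refl  = ≡ₙ-refl , ≡ₙ-refl
    ; sym   = λ (p , q) → ≡ₙ-sym p , ≡ₙ-sym q
    ; trans = λ (p , q) (r , s) → ≡ₙ-trans p r , ≡ₙ-trans q s
    }

  isCommutativeRing : IsCommutativeRing _≈_ _⊕_ _⊛_ ⊝_ (ι (+ 0)) (ι (+ 1))
  isCommutativeRing = record
    { isRing = record
      { +-isAbelianGroup = record
        { isGroup = record
          { isMonoid = record
            { isSemigroup = record
              { isMagma = record
                { isEquivalence = ≈-isEquivalence
                ; ∙-cong = λ (p , q) (r , s) → +-congₙ p r , +-congₙ q s
                }
              ; assoc = λ (a , b) (c , d) (e , f) → componentwise (+-assoc a c e) (+-assoc b d f)
              }
            ; identity = (λ (a , b) → componentwise (+-identityˡ a) (+-identityˡ b))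
                       , (λ (a , b) → componentwise (+-identityʳ a) (+-identityʳ b))
            }
          ; inverse = (λ (a , b) → componentwise (+-inverseˡ a) (+-inverseˡ b))
                    , (λ (a , b) → componentwise (+-inverseʳ a) (+-inverseʳ b))
          ; ⁻¹-cong = λ (p , q) → -‿congₙ p , -‿congₙ q
          }
        ; comm = λ (a , b) (c , d) → componentwise (+-comm a c) (+-comm b d)
        }
      ; *-cong = λ (p , q) (r , s) →
          -congₙ (*-congₙ p r) (*-congₙ q s) ,
          -congₙ (+-congₙ (*-congₙ p s) (*-congₙ q r)) (*-congₙ (≡ₙ-refl {B}) (*-congₙ q s))
      ; *-assoc = λ (a , b) (c , d) (e , f) →
          componentwise (*-assoc₁ B a b c d e f) (*-assoc₂ B a b c d e f)
      ; *-identity = (λ (a , b) → componentwise (*-identityˡ₁ a b) (*-identityˡ₂ B a b))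
                   , (λ (a , b) → componentwise (*-identityʳ₁ a b) (*-identityʳ₂ B a b))
      ; distrib = (λ (a , b) (c , d) (e , f) →
                     componentwise (distribˡ₁ a b c d e f) (distribˡ₂ B a b c d e f))
                , (λ (a , b) (c , d) (e , f) →
                     componentwise (distribʳ₁ a b c d e f) (distribʳ₂ B a b c d e f))
      }
    ; *-comm = λ (a , b) (c , d) → componentwise (*-comm₁ a b c d) (*-comm₂ B a b c d)
    }

  quadraticRing : CommutativeRing 0ℓ 0ℓ
  quadraticRing = record { isCommutativeRing = isCommutativeRing }

  ι-homomorphism : ℤ.+-*-rawRing -Raw-AlmostCommutative⟶ fromCommutativeRing quadraticRing
  ι-homomorphism = record
    { ⟦_⟧    = ι
    ; +-homo = λ _ _ → ≡ₙ-refl , ≡ₙ-refl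
    ; *-homo = λ a c → componentwise (ι-*₁ a c) (ι-*₂ B a c)
    ; -‿homo = λ _ → ≡ₙ-refl , ≡ₙ-refl
    ; 0-homo = ≡ₙ-refl , ≡ₙ-refl
    ; 1-homo = ≡ₙ-refl , ≡ₙ-refl
    }

  n∣⇒ι≈0 : ∀ {a} → + n ∣ a → ι a ≈ ι (+ 0)
  n∣⇒ι≈0 n∣a = n∣⇒≡ₙ0 n∣a , ≡ₙ-refl

  ι≈0⇒n∣ : ∀ {a} → ι a ≈ ι (+ 0) → + n ∣ a
  ι≈0⇒n∣ {a} (mod-n n∣a-0 , _) = subst (+ n ∣_) (ℤₚ.+-identityʳ a) n∣a-0

  X-root : X ⊛ X ⊕ ι B ⊛ X ⊕ ι (+ 1) ≈ ι (+ 0)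
  X-root = componentwise (X-root₁ B) (X-root₂ B)

module TwoAdic where
  open import Data.Nat using (_+_; _*_; _^_; _∸_; _<_; _≤_; z≤n; s≤s)
  open import Data.Nat.Properties
  open import Data.Nat.Divisibility using (divides; _∣?_)
  open import Data.Nat.Primality using (prime[2]; euclidsLemma)
  open import Data.Nat.Induction using (<-wellFounded; Acc; acc)
  open import Data.Nat.Tactic.RingSolver using (solve-∀)
  open import Relation.Nullary using (yes; no)
  open import Relation.Binary.PropositionalEquality using (_≡_; refl; sym; trans; cong; subst)

  private
    1+2[1+q]≡3+2q : ∀ q → suc (2 * suc q) ≡ suc (suc (suc (2 * q)))
    1+2[1+q]≡3+2q = solve-∀
    t*s*2≡2*t*s : ∀ t s → t * s * 2 ≡ 2 * t * s
    t*s*2≡2*t*s = solve-∀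
    2*t*u≡2*[t*u] : ∀ t u → 2 * t * u ≡ 2 * (t * u)
    2*t*u≡2*[t*u] = solve-∀
    2*t*u≡t*u*2 : ∀ t u → 2 * t * u ≡ t * u * 2
    2*t*u≡t*u*2 = solve-∀

  odd-* : ∀ {u v} → OddN u → OddN v → OddN (u * v)
  odd-* {u} {v} u-odd v-odd 2∣uv with euclidsLemma u v prime[2] 2∣uv
  ... | inj₁ 2∣u = u-odd 2∣u
  ... | inj₂ 2∣v = v-odd 2∣v

  odd⇒odd∸2 : ∀ {m} → OddN (suc (suc m)) → OddN m
  odd⇒odd∸2 m+2-odd (divides q m≡q*2) = m+2-odd (divides (suc q) (cong (λ k → suc (suc k)) m≡q*2))

  odd⇒≡1+2* : ∀ {m} → OddN m → ∃[ q ] m ≡ suc (2 * q)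
  odd⇒≡1+2* {zero} 0-odd = ⊥-elim (0-odd (divides 0 refl))
  odd⇒≡1+2* {suc zero} _ = 0 , refl
  odd⇒≡1+2* {suc (suc m)} m+2-odd with odd⇒≡1+2* (odd⇒odd∸2 m+2-odd)
  ... | q , m≡1+2q = suc q , trans (cong (λ k → suc (suc k)) m≡1+2q) (sym (1+2[1+q]≡3+2q q))

  2-adic-decomposition : ∀ m → 0 < m → ∃[ r ] ∃[ s ] (OddN s × m ≡ 2 ^ r * s)
  2-adic-decomposition m = go m (<-wellFounded m)
    where
    go : ∀ m → Acc _<_ m → 0 < m → ∃[ r ] ∃[ s ] (OddN s × m ≡ 2 ^ r * s)
    go m (acc smaller) 0<m with 2 ∣? m
    ... | no m-odd = 0 , m , m-odd , sym (*-identityˡ m)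
    ... | yes (divides zero m≡0) = ⊥-elim (<-irrefl (sym m≡0) 0<m)
    ... | yes (divides q@(suc _) m≡q*2)
      with go q (smaller (subst (q <_) (sym m≡q*2) (m<m*n q 2 (s≤s (s≤s z≤n))))) (s≤s z≤n)
    ...   | r , s , s-odd , q≡2^r*s =
      suc r , s , s-odd , trans m≡q*2 (trans (cong (_* 2) q≡2^r*s) (t*s*2≡2*t*s (2 ^ r) s))

  n²∸1≡[n+1]*[n∸1] : ∀ {n} → 1 ≤ n → n ^ 2 ∸ 1 ≡ suc n * (n ∸ 1)
  n²∸1≡[n+1]*[n∸1] {suc k} _ = cong (_∸ 1) (expand k)
    where
    expand : ∀ k → (1 + k) * ((1 + k) * 1) ≡ 1 + (2 + k) * k
    expand = solve-∀

  2^[k+t]*s≡2^t*s*2^k : ∀ k t s → 2 ^ (k + t) * s ≡ 2 ^ t * s * 2 ^ k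
  2^[k+t]*s≡2^t*s*2^k k t s = trans (cong (_* s) (^-distribˡ-+-* 2 k t)) (reorder (2 ^ k) (2 ^ t) s)
    where
    reorder : ∀ a b s → a * b * s ≡ b * s * a
    reorder = solve-∀

  2-adic-* : ∀ {a b r s r₂ m} → a ≡ 2 ^ r * s → b ≡ 2 ^ r₂ * m → a * b ≡ 2 ^ (r + r₂) * (s * m)
  2-adic-* {r = r} {s} {r₂} {m} refl refl =
    trans (regroup (2 ^ r) s (2 ^ r₂) m) (cong (_* (s * m)) (sym (^-distribˡ-+-* 2 r r₂)))
    where
    regroup : ∀ a s b m → a * s * (b * m) ≡ a * b * (s * m)
    regroup = solve-∀

  2-adic-unique : ∀ a b {u v} → OddN u → OddN v → 2 ^ a * u ≡ 2 ^ b * v → a ≡ b × u ≡ v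
  2-adic-unique zero zero {u} {v} _ _ eq = refl , trans (sym (*-identityˡ u)) (trans eq (*-identityˡ v))
  2-adic-unique zero (suc b) {u} {v} u-odd _ eq =
    ⊥-elim (u-odd (divides (2 ^ b * v)
      (trans (sym (*-identityˡ u)) (trans eq (2*t*u≡t*u*2 (2 ^ b) v)))))
  2-adic-unique (suc a) zero {u} {v} _ v-odd eq =
    ⊥-elim (v-odd (divides (2 ^ a * u)
      (trans (sym (*-identityˡ v)) (trans (sym eq) (2*t*u≡t*u*2 (2 ^ a) u)))))
  2-adic-unique (suc a) (suc b) {u} {v} u-odd v-odd eq
    with 2-adic-unique a b u-odd v-odd
           (*-cancelˡ-≡ (2 ^ a * u) (2 ^ b * v) 2
              (trans (sym (2*t*u≡2*[t*u] (2 ^ a) u)) (trans eq (2*t*u≡2*[t*u] (2 ^ b) v))))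
  ... | refl , u≡v = refl , u≡v

module Powers {c ℓ} (R : CommutativeRing c ℓ) where
  open import Data.Nat using (_<_; _≤_)
  import Data.Nat.Properties as ℕₚ
  open import Relation.Nullary using (¬_; yes; no)
  open import Relation.Binary.PropositionalEquality as ≡ using (_≡_)
  open CommutativeRing R
  open import Algebra.Properties.Ring ring using (-‿distribˡ-*; -‿involutive)
  open import Algebra.Properties.Semiring.Exp semiring using (_^_; ^-congˡ; ^-congʳ; ^-assocʳ)
  open import Algebra.Properties.CommutativeSemiring.Exp commutativeSemiring using (^-distrib-*)
  open import Relation.Binary.Reasoning.Setoid setoid
  open TwoAdic using (odd⇒≡1+2*; 2^[k+t]*s≡2^t*s*2^k)

  1^k≈1 : ∀ k → 1# ^ k ≈ 1#
  1^k≈1 zero = refl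
  1^k≈1 (suc k) = trans (*-identityˡ _) (1^k≈1 k)

  -1*-1≈1 : - 1# * - 1# ≈ 1#
  -1*-1≈1 = begin
    - 1# * - 1#   ≈⟨ -‿distribˡ-* 1# (- 1#) ⟨
    - (1# * - 1#) ≈⟨ -‿cong (*-identityˡ (- 1#)) ⟩
    - - 1#        ≈⟨ -‿involutive 1# ⟩
    1#            ∎

  [z*z]^k≈z^[2*k] : ∀ z k → (z * z) ^ k ≈ z ^ (2 ℕ.* k)
  [z*z]^k≈z^[2*k] z k = trans (^-congˡ k (*-congˡ (sym (*-identityʳ z)))) (^-assocʳ z 2 k)

  z*z≈1⇒z^odd≈z : ∀ {z m} → z * z ≈ 1# → OddN m → z ^ m ≈ z
  z*z≈1⇒z^odd≈z {z} {m} z*z≈1 m-odd with odd⇒≡1+2* m-odd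
  ... | q , ≡.refl = begin
    z * z ^ (2 ℕ.* q) ≈⟨ *-congˡ ([z*z]^k≈z^[2*k] z q) ⟨
    z * (z * z) ^ q   ≈⟨ *-congˡ (^-congˡ q z*z≈1) ⟩
    z * 1# ^ q        ≈⟨ *-congˡ (1^k≈1 q) ⟩
    z * 1#            ≈⟨ *-identityʳ z ⟩
    z                 ∎

  ^2^k≈1⇒^odd≈1⇒≈1 : ∀ k {z m} → OddN m → z ^ (2 ℕ.^ k) ≈ 1# → z ^ m ≈ 1# → z ≈ 1#
  ^2^k≈1⇒^odd≈1⇒≈1 zero {z} _ z^1≈1 _ = trans (sym (*-identityʳ z)) z^1≈1
  ^2^k≈1⇒^odd≈1⇒≈1 (suc k) {z} {m} m-odd z^2^[1+k]≈1 z^m≈1 =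
    trans (sym (z*z≈1⇒z^odd≈z z*z≈1 m-odd)) z^m≈1
    where
    z*z≈1 : z * z ≈ 1#
    z*z≈1 = ^2^k≈1⇒^odd≈1⇒≈1 k m-odd
      (trans ([z*z]^k≈z^[2*k] z (2 ℕ.^ k)) z^2^[1+k]≈1)
      (trans (^-distrib-* z z m) (trans (*-cong z^m≈1 z^m≈1) (*-identityˡ 1#)))

  ^2^k≈1⇒^odd≈-1⇒≈-1 : ∀ k {z m} → ¬ (1# ≈ - 1#) → OddN m →
    z ^ (2 ℕ.^ k) ≈ 1# → z ^ m ≈ - 1# → z ≈ - 1#
  ^2^k≈1⇒^odd≈-1⇒≈-1 zero {z} {m} 1≉-1 m-odd z^1≈1 z^m≈-1 = ⊥-elim (1≉-1 (begin
    1#     ≈⟨ 1^k≈1 m ⟨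
    1# ^ m ≈⟨ ^-congˡ m (trans (sym (*-identityʳ z)) z^1≈1) ⟨
    z ^ m  ≈⟨ z^m≈-1 ⟩
    - 1#   ∎))
  ^2^k≈1⇒^odd≈-1⇒≈-1 (suc k) {z} {m} _ m-odd z^2^[1+k]≈1 z^m≈-1 =
    trans (sym (z*z≈1⇒z^odd≈z z*z≈1 m-odd)) z^m≈-1
    where
    z*z≈1 : z * z ≈ 1#
    z*z≈1 = ^2^k≈1⇒^odd≈1⇒≈1 k m-odd
      (trans ([z*z]^k≈z^[2*k] z (2 ℕ.^ k)) z^2^[1+k]≈1)
      (trans (^-distrib-* z z m) (trans (*-cong z^m≈-1 z^m≈-1) -1*-1≈1))

  z^[2^[k+t]*s]≈[z^[2^t*s]]^2^k : ∀ z k t s →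
    z ^ (2 ℕ.^ (k ℕ.+ t) ℕ.* s) ≈ (z ^ (2 ℕ.^ t ℕ.* s)) ^ (2 ℕ.^ k)
  z^[2^[k+t]*s]≈[z^[2^t*s]]^2^k z k t s =
    trans (^-congʳ z (2^[k+t]*s≡2^t*s*2^k k t s)) (sym (^-assocʳ z (2 ℕ.^ t ℕ.* s) (2 ℕ.^ k)))

  ^2^t*s≈1-mono : ∀ {z s t t′} → z ^ (2 ℕ.^ t ℕ.* s) ≈ 1# → t ≤ t′ → z ^ (2 ℕ.^ t′ ℕ.* s) ≈ 1#
  ^2^t*s≈1-mono {z} {s} {t} z^2^t*s≈1 t≤t′ with ℕₚ.m≤n⇒∃[o]m+o≡n t≤t′
  ... | k , ≡.refl = begin
    z ^ (2 ℕ.^ (t ℕ.+ k) ℕ.* s)   ≈⟨ ^-congʳ z (≡.cong (λ e → 2 ℕ.^ e ℕ.* s) (ℕₚ.+-comm t k)) ⟩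
    z ^ (2 ℕ.^ (k ℕ.+ t) ℕ.* s)   ≈⟨ z^[2^[k+t]*s]≈[z^[2^t*s]]^2^k z k t s ⟩
    (z ^ (2 ℕ.^ t ℕ.* s)) ^ (2 ℕ.^ k) ≈⟨ ^-congˡ (2 ℕ.^ k) z^2^t*s≈1 ⟩
    1# ^ (2 ℕ.^ k)                 ≈⟨ 1^k≈1 (2 ℕ.^ k) ⟩
    1#                             ∎

  -- FactorRoot s j y: y is a root of the j-th factor in
  --   x^(2^r s) - 1 = (x^s - 1) (x^s + 1) (x^(2s) + 1) ⋯ (x^(2^(r-1) s) + 1).
  FactorRoot : ℕ → ℕ → Carrier → Set ℓ
  FactorRoot s zero y = y ^ s ≈ 1#
  FactorRoot s (suc t) y = y ^ (2 ℕ.^ t ℕ.* s) ≈ - 1#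

  FactorRoot⇒^2^t*s≈1 : ∀ {s j t y} → FactorRoot s j y → j ≤ t → y ^ (2 ℕ.^ t ℕ.* s) ≈ 1#
  FactorRoot⇒^2^t*s≈1 {s} {zero} {y = y} y^s≈1 =
    ^2^t*s≈1-mono (trans (^-congʳ y (ℕₚ.*-identityˡ s)) y^s≈1)
  FactorRoot⇒^2^t*s≈1 {s} {suc t} {y = y} y^2^t*s≈-1 = ^2^t*s≈1-mono (begin
    y ^ (2 ℕ.^ (1 ℕ.+ t) ℕ.* s)       ≈⟨ z^[2^[k+t]*s]≈[z^[2^t*s]]^2^k y 1 t s ⟩
    (y ^ (2 ℕ.^ t ℕ.* s)) ^ 2         ≈⟨ ^-congˡ 2 y^2^t*s≈-1 ⟩
    (- 1#) ^ 2                        ≈⟨ *-congˡ (*-identityʳ (- 1#)) ⟩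
    - 1# * - 1#                       ≈⟨ -1*-1≈1 ⟩
    1#                                ∎)

  FactorRoot-inverses : ∀ {s j k u v} → ¬ (1# ≈ - 1#) →
    FactorRoot s j u → FactorRoot s k v → u * v ≈ 1# → ¬ (j < k)
  FactorRoot-inverses {s} {j} {suc t} {u} {v} 1≉-1 u-root v^2^t*s≈-1 u*v≈1 (s≤s j≤t) =
    1≉-1 (begin
      1#              ≈⟨ 1^k≈1 e ⟨
      1# ^ e          ≈⟨ ^-congˡ e u*v≈1 ⟨
      (u * v) ^ e     ≈⟨ ^-distrib-* u v e ⟩
      u ^ e * v ^ e   ≈⟨ *-cong (FactorRoot⇒^2^t*s≈1 u-root j≤t) v^2^t*s≈-1 ⟩
      1# * - 1#       ≈⟨ *-identityˡ (- 1#) ⟩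
      - 1#            ∎)
    where
    e : ℕ
    e = 2 ℕ.^ t ℕ.* s

  FactorRoot-oddPart : ∀ {r s m j y} → ¬ (1# ≈ - 1#) → OddN m → y ^ (2 ℕ.^ r ℕ.* s) ≈ 1# →
    FactorRoot (s ℕ.* m) j y → j ≤ r × FactorRoot s j y
  FactorRoot-oddPart {r} {s} {m} {zero} {y} _ m-odd y^2^r*s≈1 y^sm≈1 =
    z≤n , ^2^k≈1⇒^odd≈1⇒≈1 r m-odd
      (trans (^-assocʳ y s (2 ℕ.^ r)) (trans (^-congʳ y (ℕₚ.*-comm s (2 ℕ.^ r))) y^2^r*s≈1))
      (trans (^-assocʳ y s m) y^sm≈1)
  FactorRoot-oddPart {r} {s} {m} {suc t} {y} 1≉-1 m-odd y^2^r*s≈1 y^2^t*sm≈-1 with t ℕ.<? r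
  ... | no t≮r = ⊥-elim (1≉-1 (begin
    1#                              ≈⟨ 1^k≈1 m ⟨
    1# ^ m                          ≈⟨ ^-congˡ m (^2^t*s≈1-mono y^2^r*s≈1 (ℕₚ.≮⇒≥ t≮r)) ⟨
    (y ^ (2 ℕ.^ t ℕ.* s)) ^ m       ≈⟨ ^-assocʳ y (2 ℕ.^ t ℕ.* s) m ⟩
    y ^ (2 ℕ.^ t ℕ.* s ℕ.* m)       ≈⟨ ^-congʳ y (ℕₚ.*-assoc (2 ℕ.^ t) s m) ⟩
    y ^ (2 ℕ.^ t ℕ.* (s ℕ.* m))     ≈⟨ y^2^t*sm≈-1 ⟩
    - 1#                            ∎))
  ... | yes t<r with ℕₚ.m≤n⇒∃[o]m+o≡n t<r
  ...   | k , ≡.refl = t<r , ^2^k≈1⇒^odd≈-1⇒≈-1 (suc k) 1≉-1 m-odd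
    (trans (sym (z^[2^[k+t]*s]≈[z^[2^t*s]]^2^k y (suc k) t s))
           (trans (^-congʳ y (≡.cong (λ e → 2 ℕ.^ suc e ℕ.* s) (ℕₚ.+-comm k t))) y^2^r*s≈1))
    (trans (^-assocʳ y (2 ℕ.^ t ℕ.* s) m)
           (trans (^-congʳ y (ℕₚ.*-assoc (2 ℕ.^ t) s m)) y^2^t*sm≈-1))

module JacobiSymbol where
  open import Data.Integer using (_+_; _-_; _*_; -_)
  open import Data.Integer.Divisibility.Signed
  open import Data.Integer.Tactic.RingSolver using (solve-∀)
  import Data.Nat.Divisibility as ℕᵈ
  open import Relation.Binary.PropositionalEquality using (_≡_; sym; subst)

  private
    recombine : ∀ a b k → b ≡ (b - k * k * a) + k * k * a
    recombine = solve-∀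
    scaled-root : ∀ a b k x → (k * x) * (k * x) - b ≡ k * k * (x * x - a) - (b - k * k * a)
    scaled-root = solve-∀

  LegendreRel-transfer : ∀ {p a b k k′ l} → + p ∣ a - k * k * b → + p ∣ b - k′ * k′ * a →
    LegendreRel a p l → LegendreRel b p l
  LegendreRel-transfer {p} {a} {b} {k} {k′} _ b≡k′²a (divides p∣a) =
    divides (∣⇒∣ᵤ (subst (+ p ∣_) (sym (recombine a b k′))
      (∣m∣n⇒∣m+n b≡k′²a (∣n⇒∣m*n (k′ * k′) (∣ᵤ⇒∣ p∣a)))))
  LegendreRel-transfer {p} {a} {b} {k} {k′} a≡k²b b≡k′²a (residue p∤a (x , x²≡a)) =
    residue
      (λ p∣b → p∤a (∣⇒∣ᵤ (subst (+ p ∣_) (sym (recombine b a k))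
        (∣m∣n⇒∣m+n a≡k²b (∣n⇒∣m*n (k * k) (∣ᵤ⇒∣ p∣b))))))
      (k′ * x , ∣⇒∣ᵤ (subst (+ p ∣_) (sym (scaled-root a b k′ x))
        (∣m∣n⇒∣m-n (∣n⇒∣m*n (k′ * k′) (∣ᵤ⇒∣ x²≡a)) b≡k′²a)))
  LegendreRel-transfer {p} {a} {b} {k} {k′} a≡k²b _ (nonresidue a-nonresidue) =
    nonresidue λ (y , y²≡b) → a-nonresidue (k * y , ∣⇒∣ᵤ (subst (+ p ∣_) (sym (scaled-root b a k y))
      (∣m∣n⇒∣m-n (∣n⇒∣m*n (k * k) (∣ᵤ⇒∣ y²≡b)) a≡k²b)))

  ≡k²⇒≡k′² : ∀ {n a b k k′} → + n ∣ a - k * k * b → + n ∣ k * k′ - + 1 → + n ∣ b - k′ * k′ * a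
  ≡k²⇒≡k′² {n} {a} {b} {k} {k′} a≡k²b kk′≡1 =
    subst (+ n ∣_) (sym (expand a b k k′))
      (∣m∣n⇒∣m-n (∣n⇒∣m*n (- (k′ * k′)) a≡k²b) (∣m⇒∣m*n ((k * k′ + + 1) * b) kk′≡1))
    where
    expand : ∀ a b k k′ →
      b - k′ * k′ * a ≡ - (k′ * k′) * (a - k * k * b) - (k * k′ - + 1) * ((k * k′ + + 1) * b)
    expand = solve-∀

  JacobiRel-transfer : ∀ {n a b k k′ j} → + n ∣ a - k * k * b → + n ∣ k * k′ - + 1 →
    JacobiRel a n j → JacobiRel b n j
  JacobiRel-transfer {n} {a} {b} {k} {k′} a≡k²b kk′≡1 = go ℕᵈ.∣-refl
    where
    b≡k′²a : + n ∣ b - k′ * k′ * a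
    b≡k′²a = ≡k²⇒≡k′² {n} {a} {b} {k} {k′} a≡k²b kk′≡1
    go : ∀ {m j} → m ℕᵈ.∣ n → JacobiRel a m j → JacobiRel b m j
    go _ one = one
    go pm∣n (step {p} {m} p-prime legendre jacobi) =
      step p-prime
        (LegendreRel-transfer {k = k} {k′} (∣-trans p∣n a≡k²b) (∣-trans p∣n b≡k′²a) legendre)
        (go (ℕᵈ.∣-trans (ℕᵈ.n∣m*n p) pm∣n) jacobi)
      where
      p∣n : + p ∣ + n
      p∣n = ∣ᵤ⇒∣ (ℕᵈ.∣-trans (ℕᵈ.m∣m*n m) pm∣n)

module ModularInverse where
  open import Data.Nat.Coprimality using (Coprime; coprime-Bézout)
  open import Data.Nat.GCD using (module Bézout)
  open import Data.Integer using (_+_; _-_; _*_; -_; ∣_∣)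
  import Data.Integer.Properties as ℤₚ
  open import Data.Integer.Divisibility.Signed using (_∣_; divides)
  open import Data.Integer.Tactic.RingSolver using (solve-∀)
  open import Relation.Binary.PropositionalEquality using (_≡_; sym; trans; cong; subst)

  private
    1+u*v≡w*n : ∀ u v w n → 1 ℕ.+ u ℕ.* v ≡ w ℕ.* n → + 1 + + u * + v ≡ + w * + n
    1+u*v≡w*n u v w n eq =
      trans (cong (_+_ (+ 1)) (sym (ℤₚ.pos-* u v))) (trans (cong +_ eq) (ℤₚ.pos-* w n))

    negative-witness : ∀ m y x n → + 1 + y * m ≡ x * n → m * - y - + 1 ≡ - x * n
    negative-witness m y x n eq = trans (rearrange m y) (trans (cong -_ eq) (ℤₚ.neg-distribˡ-* x n))
      where
      rearrange : ∀ m y → m * - y - + 1 ≡ - (+ 1 + y * m)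
      rearrange = solve-∀

    positive-witness : ∀ m y x n → + 1 + x * n ≡ y * m → m * y - + 1 ≡ x * n
    positive-witness m y x n eq =
      trans (cong (_- + 1) (trans (ℤₚ.*-comm m y) (sym eq))) (cancel (x * n))
      where
      cancel : ∀ z → (+ 1 + z) - + 1 ≡ z
      cancel = solve-∀

  inverse-mod : ∀ n m → Coprime n m → ∃[ w ] + n ∣ + m * w - + 1
  inverse-mod n m n⊥m with coprime-Bézout n⊥m
  ... | Bézout.+- x y eq =
    - + y , divides (- + x) (negative-witness (+ m) (+ y) (+ x) (+ n) (1+u*v≡w*n y m x n eq))
  ... | Bézout.-+ x y eq =
    + y , divides (+ x) (positive-witness (+ m) (+ y) (+ x) (+ n) (1+u*v≡w*n x n y m eq))

  ℤ-inverse-mod : ∀ n a → Coprime n ∣ a ∣ → ∃[ w ] + n ∣ a * w - + 1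
  ℤ-inverse-mod n a n⊥a with inverse-mod n ∣ a ∣ n⊥a | ℤₚ.+∣i∣≡i⊎+∣i∣≡-i a
  ... | w , n∣∣a∣w-1 | inj₁ ∣a∣≡a  = w , subst (λ b → + n ∣ b * w - + 1) ∣a∣≡a n∣∣a∣w-1
  ... | w , n∣∣a∣w-1 | inj₂ ∣a∣≡-a =
    - w , subst (λ b → + n ∣ b - + 1)
            (trans (cong (_* w) ∣a∣≡-a) (trans (sym (ℤₚ.neg-distribˡ-* a w)) (ℤₚ.neg-distribʳ-* a w)))
            n∣∣a∣w-1

  inverse-of-factor : ∀ n a b → Coprime n ∣ a * b ∣ → ∃[ w ] + n ∣ a * w - + 1
  inverse-of-factor n a b n⊥ab with ℤ-inverse-mod n (a * b) n⊥ab
  ... | w , n∣abw-1 = b * w , subst (λ c → + n ∣ c - + 1) (ℤₚ.*-assoc a b w) n∣abw-1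

module MonicDegree (n : ℕ) where
  import Data.Nat.Properties as ℕₚ
  import Data.Nat.Divisibility as ℕᵈ
  open import Data.Integer using (_+_; _-_; _*_; -_)
  import Data.Integer.Properties as ℤₚ
  open import Data.Integer.Divisibility.Signed using (_∣_; divides; ∣ᵤ⇒∣)
  open import Data.List using (length)
  open import Data.List.Properties using (length-map)
  open import Data.List.Relation.Unary.All using (All; []; _∷_)
  open import Relation.Binary.PropositionalEquality using (_≡_; refl; sym; trans; cong; subst)
  open import Relation.Binary.Definitions using (tri<; tri≈; tri>)
  open import Relation.Nullary using (¬_)
  open Congruence n

  coeff : Poly → ℕ → ℤ
  coeff [] k = + 0
  coeff (a ∷ p) zero = a
  coeff (a ∷ p) (suc k) = coeff p k

  coeff-+ᴾ : ∀ p q k → coeff (p +ᴾ q) k ≡ coeff p k + coeff q k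
  coeff-+ᴾ [] q k = sym (ℤₚ.+-identityˡ _)
  coeff-+ᴾ (a ∷ p) [] k = sym (ℤₚ.+-identityʳ _)
  coeff-+ᴾ (a ∷ p) (b ∷ q) zero = refl
  coeff-+ᴾ (a ∷ p) (b ∷ q) (suc k) = coeff-+ᴾ p q k

  coeff-scaleᴾ : ∀ c p k → coeff (scaleᴾ c p) k ≡ c * coeff p k
  coeff-scaleᴾ c [] k = sym (ℤₚ.*-zeroʳ c)
  coeff-scaleᴾ c (a ∷ p) zero = refl
  coeff-scaleᴾ c (a ∷ p) (suc k) = coeff-scaleᴾ c p k

  coeff-minusᴾ : ∀ p q k → coeff (p -ᴾ q) k ≡ coeff p k - coeff q k
  coeff-minusᴾ p q k = trans (coeff-+ᴾ p _ k)
    (cong (_+_ (coeff p k)) (trans (coeff-scaleᴾ (- + 1) q k) (ℤₚ.-1*i≡-i (coeff q k))))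

  coeff-divisible : ∀ {r} → All (λ c → + n Unsigned.∣ c) r → ∀ k → + n ∣ coeff r k
  coeff-divisible [] k = divides (+ 0) refl
  coeff-divisible (n∣a ∷ _) zero = ∣ᵤ⇒∣ n∣a
  coeff-divisible (_ ∷ n∣r) (suc k) = coeff-divisible n∣r k

  ≈[n]⇒coeff≡ₙ : ∀ p q → p ≈[ n ] q → ∀ k → coeff p k ≡ₙ coeff q k
  ≈[n]⇒coeff≡ₙ p q p≈q k = mod-n (subst (+ n ∣_) (coeff-minusᴾ p q k) (coeff-divisible p≈q k))

  data MonicOfDegree : Poly → ℕ → Set where
    lead : ∀ {c} → c ≡ₙ + 1 → MonicOfDegree (c ∷ []) 0
    cons : ∀ c {p d} → MonicOfDegree p d → MonicOfDegree (c ∷ p) (suc d)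

  Monic⇒MonicOfDegree : ∀ p → Monic n p → MonicOfDegree p (deg p)
  Monic⇒MonicOfDegree [] (_ , () , _)
  Monic⇒MonicOfDegree (a ∷ []) (_ , refl , n∣a-1) = lead (mod-n (∣ᵤ⇒∣ n∣a-1))
  Monic⇒MonicOfDegree (a ∷ b ∷ p) monic = cons a (Monic⇒MonicOfDegree (b ∷ p) monic)

  MonicOfDegree-length : ∀ {p d} → MonicOfDegree p d → length p ≡ suc d
  MonicOfDegree-length (lead _) = refl
  MonicOfDegree-length (cons _ m) = cong suc (MonicOfDegree-length m)

  MonicOfDegree-leading : ∀ {p d} → MonicOfDegree p d → coeff p d ≡ₙ + 1
  MonicOfDegree-leading (lead c≡1) = c≡1
  MonicOfDegree-leading (cons _ m) = MonicOfDegree-leading m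

  MonicOfDegree-vanishing : ∀ {p d} → MonicOfDegree p d → ∀ {k} → d ℕ.< k → coeff p k ≡ + 0
  MonicOfDegree-vanishing (lead _) {suc k} _ = refl
  MonicOfDegree-vanishing (cons _ m) {suc k} (s≤s d<k) = MonicOfDegree-vanishing m d<k

  MonicOfDegree-≮ : 1 ℕ.< n → ∀ {p q d e} → MonicOfDegree p d → MonicOfDegree q e →
    (∀ k → coeff p k ≡ₙ coeff q k) → ¬ (d ℕ.< e)
  MonicOfDegree-≮ 1<n {q = q} {e = e} mp mq p≡q d<e =
    0≢ₙ1 1<n (≡ₙ-trans (subst (_≡ₙ coeff q e) (MonicOfDegree-vanishing mp d<e) (p≡q e))
                        (MonicOfDegree-leading mq))

  MonicOfDegree-unique : 1 ℕ.< n → ∀ {p q d e} → MonicOfDegree p d → MonicOfDegree q e →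
    (∀ k → coeff p k ≡ₙ coeff q k) → d ≡ e
  MonicOfDegree-unique 1<n {d = d} {e} mp mq p≡q with ℕₚ.<-cmp d e
  ... | tri≈ _ d≡e _ = d≡e
  ... | tri< d<e _ _ = ⊥-elim (MonicOfDegree-≮ 1<n mp mq p≡q d<e)
  ... | tri> _ _ e<d = ⊥-elim (MonicOfDegree-≮ 1<n mq mp (λ k → ≡ₙ-sym (p≡q k)) e<d)

  private
    +ᴾ-[] : ∀ p → p +ᴾ [] ≡ p
    +ᴾ-[] [] = refl
    +ᴾ-[] (a ∷ p) = refl

  +ᴾ-MonicOfDegreeʳ : ∀ s {p d} → length s ℕ.≤ d → MonicOfDegree p d → MonicOfDegree (s +ᴾ p) d
  +ᴾ-MonicOfDegreeʳ [] _ m = m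
  +ᴾ-MonicOfDegreeʳ (a ∷ s) (s≤s ∣s∣≤d) (cons c m) = cons (a + c) (+ᴾ-MonicOfDegreeʳ s ∣s∣≤d m)

  +ᴾ-zero-MonicOfDegree : ∀ {p d} → MonicOfDegree p d → MonicOfDegree (p +ᴾ (+ 0 ∷ [])) d
  +ᴾ-zero-MonicOfDegree (lead {c} c≡1) = lead (subst (_≡ₙ + 1) (sym (ℤₚ.+-identityʳ c)) c≡1)
  +ᴾ-zero-MonicOfDegree (cons c {p} m) =
    subst (λ r → MonicOfDegree ((c + + 0) ∷ r) _) (sym (+ᴾ-[] p)) (cons _ m)

  scaleᴾ-MonicOfDegree : ∀ {c q e} → c ≡ₙ + 1 → MonicOfDegree q e → MonicOfDegree (scaleᴾ c q) e
  scaleᴾ-MonicOfDegree c≡1 (lead a≡1) = lead (*-congₙ c≡1 a≡1)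
  scaleᴾ-MonicOfDegree c≡1 (cons a m) = cons _ (scaleᴾ-MonicOfDegree c≡1 m)

  *ᴾ-MonicOfDegree : ∀ {p q d e} → MonicOfDegree p d → MonicOfDegree q e →
    MonicOfDegree (p *ᴾ q) (d ℕ.+ e)
  *ᴾ-MonicOfDegree (lead c≡1) mq = +ᴾ-zero-MonicOfDegree (scaleᴾ-MonicOfDegree c≡1 mq)
  *ᴾ-MonicOfDegree {q = q} {suc d} {e} (cons c mp) mq =
    +ᴾ-MonicOfDegreeʳ (scaleᴾ c q) ∣cq∣≤1+d+e (cons (+ 0) (*ᴾ-MonicOfDegree mp mq))
    where
    ∣cq∣≤1+d+e : length (scaleᴾ c q) ℕ.≤ suc (d ℕ.+ e)
    ∣cq∣≤1+d+e = subst (ℕ._≤ suc (d ℕ.+ e))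
                   (sym (trans (length-map (c *_) q) (MonicOfDegree-length mq))) (s≤s (ℕₚ.m≤n+m e d))

  Σ≤ : (ℕ → ℕ) → ℕ → ℕ
  Σ≤ g zero = g 0
  Σ≤ g (suc r) = Σ≤ g r ℕ.+ g (suc r)

  Σ≤-∣ : ∀ {d g} r → (∀ j → j ℕ.≤ r → d ℕᵈ.∣ g j) → d ℕᵈ.∣ Σ≤ g r
  Σ≤-∣ zero d∣g = d∣g 0 z≤n
  Σ≤-∣ (suc r) d∣g =
    ℕᵈ.∣m∣n⇒∣m+n (Σ≤-∣ r (λ j j≤r → d∣g j (ℕₚ.m≤n⇒m≤1+n j≤r))) (d∣g (suc r) ℕₚ.≤-refl)

  MonicFactors : (ℕ → Poly) → (ℕ → ℕ) → ℕ → Set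
  MonicFactors G dg r = ∀ j → j ℕ.≤ r → MonicOfDegree (G j) (dg j)

  prodUpTo-MonicOfDegree : ∀ {G dg} r → MonicFactors G dg r →
    MonicOfDegree (prodUpTo G r) (Σ≤ dg r)
  prodUpTo-MonicOfDegree zero mG = mG 0 z≤n
  prodUpTo-MonicOfDegree (suc r) mG =
    *ᴾ-MonicOfDegree (prodUpTo-MonicOfDegree r (λ j j≤r → mG j (ℕₚ.m≤n⇒m≤1+n j≤r)))
      (mG (suc r) ℕₚ.≤-refl)

module IntegerAlgebra {c ℓ} (R : CommutativeRing c ℓ)
  (hom : ℤ.+-*-rawRing -Raw-AlmostCommutative⟶ fromCommutativeRing R) where
  open import Data.Maybe using (just; nothing)
  open import Relation.Nullary using (yes; no)
  import Relation.Binary.PropositionalEquality as ≡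
  open ≡ using (_≡_)
  open import Relation.Binary.Definitions using (WeaklyDecidable)
  open import Algebra.Solver.Ring.AlmostCommutativeRing using (Induced-equivalence)
  import Data.Nat.Properties as ℕₚ
  open import Data.List.Relation.Unary.All using (All; []; _∷_)
  open CommutativeRing R
  open import Algebra.Properties.Ring ring using (x∙y⁻¹≈ε⇒x≈y; +-inverseˡ-unique)
  open import Relation.Binary.Reasoning.Setoid setoid
  open import Algebra.Properties.Semiring.Exp semiring using (_^_)
  open _-Raw-AlmostCommutative⟶_ hom public using (⟦_⟧; +-homo; *-homo; -‿homo; 0-homo; 1-homo)

  private
    ⟦⟧-weaklyDecidable : WeaklyDecidable (Induced-equivalence hom)
    ⟦⟧-weaklyDecidable a b with a ℤ.≟ b
    ... | yes ≡.refl = just refl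
    ... | no _ = nothing

  open import Algebra.Solver.Ring ℤ.+-*-rawRing (fromCommutativeRing R) hom ⟦⟧-weaklyDecidable public
    using (solve; _:=_; _:+_; _:*_; :-_; _:-_; con)

  ⟦a-b⟧≈⟦a⟧-⟦b⟧ : ∀ a b → ⟦ a ℤ.- b ⟧ ≈ ⟦ a ⟧ - ⟦ b ⟧
  ⟦a-b⟧≈⟦a⟧-⟦b⟧ a b = trans (+-homo a (ℤ.- b)) (+-congˡ (-‿homo b))

  eval : Poly → Carrier → Carrier
  eval [] y = 0#
  eval (a ∷ p) y = ⟦ a ⟧ + y * eval p y

  private
    horner-+ : ∀ a b y u v → (a + b) + y * (u + v) ≈ (a + y * u) + (b + y * v)
    horner-+ = solve 5 (λ a b y u v → (a :+ b) :+ y :* (u :+ v) := (a :+ y :* u) :+ (b :+ y :* v))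
                 refl
    horner-scale : ∀ c a y u → c * a + y * (c * u) ≈ c * (a + y * u)
    horner-scale = solve 4 (λ c a y u → c :* a :+ y :* (c :* u) := c :* (a :+ y :* u)) refl
    horner-* : ∀ a u y q → a * q + y * (u * q) ≈ (a + y * u) * q
    horner-* = solve 4 (λ a u y q → a :* q :+ y :* (u :* q) := (a :+ y :* u) :* q) refl
    u+[-1]v≈u-v : ∀ u v → u + ⟦ ℤ.- + 1 ⟧ * v ≈ u - v
    u+[-1]v≈u-v = solve 2 (λ u v → u :+ con (ℤ.- + 1) :* v := u :- v) refl

  eval-+ᴾ : ∀ p q y → eval (p +ᴾ q) y ≈ eval p y + eval q y
  eval-+ᴾ [] q y = sym (+-identityˡ _)
  eval-+ᴾ (a ∷ p) [] y = sym (+-identityʳ _)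
  eval-+ᴾ (a ∷ p) (b ∷ q) y = begin
    ⟦ a ℤ.+ b ⟧ + y * eval (p +ᴾ q) y          ≈⟨ +-cong (+-homo a b) (*-congˡ (eval-+ᴾ p q y)) ⟩
    (⟦ a ⟧ + ⟦ b ⟧) + y * (eval p y + eval q y) ≈⟨ horner-+ _ _ _ _ _ ⟩
    eval (a ∷ p) y + eval (b ∷ q) y            ∎

  eval-scaleᴾ : ∀ c p y → eval (scaleᴾ c p) y ≈ ⟦ c ⟧ * eval p y
  eval-scaleᴾ c [] y = sym (zeroʳ _)
  eval-scaleᴾ c (a ∷ p) y = begin
    ⟦ c ℤ.* a ⟧ + y * eval (scaleᴾ c p) y ≈⟨ +-cong (*-homo c a) (*-congˡ (eval-scaleᴾ c p y)) ⟩
    ⟦ c ⟧ * ⟦ a ⟧ + y * (⟦ c ⟧ * eval p y) ≈⟨ horner-scale _ _ _ _ ⟩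
    ⟦ c ⟧ * eval (a ∷ p) y                ∎

  eval-*ᴾ : ∀ p q y → eval (p *ᴾ q) y ≈ eval p y * eval q y
  eval-*ᴾ [] q y = sym (zeroˡ _)
  eval-*ᴾ (a ∷ p) q y = begin
    eval (scaleᴾ a q +ᴾ (+ 0 ∷ (p *ᴾ q))) y               ≈⟨ eval-+ᴾ (scaleᴾ a q) (+ 0 ∷ (p *ᴾ q)) y ⟩
    eval (scaleᴾ a q) y + (⟦ + 0 ⟧ + y * eval (p *ᴾ q) y)  ≈⟨ +-cong (eval-scaleᴾ a q y)
                                                               (+-cong 0-homo (*-congˡ (eval-*ᴾ p q y))) ⟩
    ⟦ a ⟧ * eval q y + (0# + y * (eval p y * eval q y))    ≈⟨ +-congˡ (+-identityˡ _) ⟩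
    ⟦ a ⟧ * eval q y + y * (eval p y * eval q y)           ≈⟨ horner-* _ _ _ _ ⟩
    eval (a ∷ p) y * eval q y                              ∎

  eval-minusᴾ : ∀ p q y → eval (p -ᴾ q) y ≈ eval p y - eval q y
  eval-minusᴾ p q y = begin
    eval (p +ᴾ scaleᴾ (ℤ.- + 1) q) y           ≈⟨ eval-+ᴾ p (scaleᴾ (ℤ.- + 1) q) y ⟩
    eval p y + eval (scaleᴾ (ℤ.- + 1) q) y     ≈⟨ +-congˡ (eval-scaleᴾ _ q y) ⟩
    eval p y + ⟦ ℤ.- + 1 ⟧ * eval q y          ≈⟨ u+[-1]v≈u-v _ _ ⟩
    eval p y - eval q y                        ∎

  eval-constᴾ : ∀ c y → eval (constᴾ c) y ≈ ⟦ c ⟧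
  eval-constᴾ c y = trans (+-congˡ (zeroʳ y)) (+-identityʳ _)

  eval-monoᴾ : ∀ k y → eval (monoᴾ k) y ≈ y ^ k
  eval-monoᴾ zero y = trans (eval-constᴾ (+ 1) y) 1-homo
  eval-monoᴾ (suc k) y = trans (+-cong 0-homo (*-congˡ (eval-monoᴾ k y))) (+-identityˡ _)

  eval-composeᴾ : ∀ p q y → eval (composeᴾ p q) y ≈ eval p (eval q y)
  eval-composeᴾ [] q y = refl
  eval-composeᴾ (a ∷ p) q y = begin
    eval (constᴾ a +ᴾ q *ᴾ composeᴾ p q) y                 ≈⟨ eval-+ᴾ (constᴾ a) (q *ᴾ composeᴾ p q) y ⟩
    eval (constᴾ a) y + eval (q *ᴾ composeᴾ p q) y         ≈⟨ +-cong (eval-constᴾ a y) (eval-*ᴾ q _ y) ⟩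
    ⟦ a ⟧ + eval q y * eval (composeᴾ p q) y               ≈⟨ +-congˡ (*-congˡ (eval-composeᴾ p q y)) ⟩
    eval (a ∷ p) (eval q y)                                ∎

  eval-xᵏ-1≈0⇒yᵏ≈1 : ∀ k y → eval (monoᴾ k -ᴾ constᴾ (+ 1)) y ≈ 0# → y ^ k ≈ 1#
  eval-xᵏ-1≈0⇒yᵏ≈1 k y root = x∙y⁻¹≈ε⇒x≈y _ _ (begin
    y ^ k - 1#                                   ≈⟨ +-cong (eval-monoᴾ k y)
                                                      (-‿cong (trans (eval-constᴾ (+ 1) y) 1-homo)) ⟨
    eval (monoᴾ k) y - eval (constᴾ (+ 1)) y     ≈⟨ eval-minusᴾ (monoᴾ k) (constᴾ (+ 1)) y ⟨
    eval (monoᴾ k -ᴾ constᴾ (+ 1)) y             ≈⟨ root ⟩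
    0#                                           ∎)

  eval-xᵏ+1≈0⇒yᵏ≈-1 : ∀ k y → eval (monoᴾ k +ᴾ constᴾ (+ 1)) y ≈ 0# → y ^ k ≈ - 1#
  eval-xᵏ+1≈0⇒yᵏ≈-1 k y root = +-inverseˡ-unique _ _ (begin
    y ^ k + 1#                                   ≈⟨ +-cong (eval-monoᴾ k y)
                                                      (trans (eval-constᴾ (+ 1) y) 1-homo) ⟨
    eval (monoᴾ k) y + eval (constᴾ (+ 1)) y     ≈⟨ eval-+ᴾ (monoᴾ k) (constᴾ (+ 1)) y ⟨
    eval (monoᴾ k +ᴾ constᴾ (+ 1)) y             ≈⟨ root ⟩
    0#                                           ∎)

  eval-congʳ : ∀ p {y y′} → y ≈ y′ → eval p y ≈ eval p y′
  eval-congʳ [] _ = refl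
  eval-congʳ (a ∷ p) y≈y′ = +-congˡ (*-cong y≈y′ (eval-congʳ p y≈y′))

  module Modulo (n : ℕ) (⟦n∣⟧≈0 : ∀ {a} → + n Signed.∣ a → ⟦ a ⟧ ≈ 0#) where
    open Congruence n
    open MonicDegree n

    ⟦⟧-cong-≡ₙ : ∀ {a b} → a ≡ₙ b → ⟦ a ⟧ ≈ ⟦ b ⟧
    ⟦⟧-cong-≡ₙ {a} {b} (mod-n n∣a-b) =
      x∙y⁻¹≈ε⇒x≈y _ _ (trans (sym (⟦a-b⟧≈⟦a⟧-⟦b⟧ a b)) (⟦n∣⟧≈0 n∣a-b))

    ⟦⟧-inverse : ∀ {a b} → + n Signed.∣ a ℤ.* b ℤ.- + 1 → ⟦ a ⟧ * ⟦ b ⟧ ≈ 1#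
    ⟦⟧-inverse {a} {b} ab≡1 = trans (sym (*-homo a b)) (trans (⟦⟧-cong-≡ₙ (mod-n ab≡1)) 1-homo)

    eval-≈[n] : ∀ p q y → p ≈[ n ] q → eval p y ≈ eval q y
    eval-≈[n] p q y p≈q = x∙y⁻¹≈ε⇒x≈y _ _ (trans (sym (eval-minusᴾ p q y)) (divisible (p -ᴾ q) p≈q))
      where
      divisible : ∀ r → All (λ c → + n Unsigned.∣ c) r → eval r y ≈ 0#
      divisible [] [] = refl
      divisible (a ∷ r) (n∣a ∷ n∣r) = begin
        ⟦ a ⟧ + y * eval r y ≈⟨ +-cong (⟦n∣⟧≈0 (Signed.∣ᵤ⇒∣ n∣a)) (*-congˡ (divisible r n∣r)) ⟩
        0# + y * 0#          ≈⟨ trans (+-identityˡ _) (zeroʳ y) ⟩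
        0#                   ∎

    MonicOfDegree0-eval : ∀ {p} → MonicOfDegree p 0 → ∀ y → eval p y ≈ 1#
    MonicOfDegree0-eval (lead c≡1) y = trans (eval-constᴾ _ y) (trans (⟦⟧-cong-≡ₙ c≡1) 1-homo)

    MonicOfDegree1-eval : ∀ {p} → MonicOfDegree p 1 → ∃[ a ] ∀ y → eval p y ≈ ⟦ a ⟧ + y
    MonicOfDegree1-eval (cons a m) =
      a , λ y → +-congˡ (trans (*-congˡ (MonicOfDegree0-eval m y)) (*-identityʳ y))

    divisor-root : ∀ g c h {y} → g ≈[ n ] (c *ᴾ h) → eval h y ≈ 0# → eval g y ≈ 0#
    divisor-root g c h {y} g≈ch h[y]≈0 = begin
      eval g y             ≈⟨ eval-≈[n] g (c *ᴾ h) y g≈ch ⟩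
      eval (c *ᴾ h) y      ≈⟨ eval-*ᴾ c h y ⟩
      eval c y * eval h y  ≈⟨ *-congˡ h[y]≈0 ⟩
      eval c y * 0#        ≈⟨ zeroʳ _ ⟩
      0#                   ∎

    IsGcmd-root : ∀ {g₁ g₂ h y} → IsGcmd n g₁ g₂ h → eval h y ≈ 0# → eval g₂ y ≈ 0#
    IsGcmd-root {g₂ = g₂} {h} (_ , _ , _ , c , g₂≈ch) = divisor-root g₂ c h g₂≈ch

    IsGcmd-Bézout : ∀ {g₁ g₂ h} → IsGcmd n g₁ g₂ h →
      ∃[ a ] ∃[ b ] ∀ y → eval a y * eval g₁ y + eval b y * eval g₂ y ≈ eval h y
    IsGcmd-Bézout {g₁} {g₂} {h} (_ , (a , b , ag₁+bg₂≈h) , _) = a , b , λ y → begin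
      eval a y * eval g₁ y + eval b y * eval g₂ y   ≈⟨ +-cong (eval-*ᴾ a g₁ y) (eval-*ᴾ b g₂ y) ⟨
      eval (a *ᴾ g₁) y + eval (b *ᴾ g₂) y           ≈⟨ eval-+ᴾ (a *ᴾ g₁) (b *ᴾ g₂) y ⟨
      eval (a *ᴾ g₁ +ᴾ b *ᴾ g₂) y                   ≈⟨ eval-≈[n] _ h y ag₁+bg₂≈h ⟩
      eval h y                                      ∎

    module _ {G : ℕ → Poly} {dg : ℕ → ℕ} where
      private
        init : ∀ {r} → MonicFactors G dg (suc r) → MonicFactors G dg r
        init mG j j≤r = mG j (ℕₚ.m≤n⇒m≤1+n j≤r)

        final : ∀ {r d} → MonicFactors G dg (suc r) → dg (suc r) ≡ d → MonicOfDegree (G (suc r)) d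
        final mG ≡.refl = mG _ ℕₚ.≤-refl

        times-unitʳ : ∀ {r} → (∀ y → eval (G (suc r)) y ≈ 1#) →
          ∀ y → eval (prodUpTo G (suc r)) y ≈ eval (prodUpTo G r) y
        times-unitʳ {r} G[y]≈1 y =
          trans (eval-*ᴾ (prodUpTo G r) (G (suc r)) y) (trans (*-congˡ (G[y]≈1 y)) (*-identityʳ _))

        times-unitˡ : ∀ {r} → (∀ y → eval (prodUpTo G r) y ≈ 1#) →
          ∀ y → eval (prodUpTo G (suc r)) y ≈ eval (G (suc r)) y
        times-unitˡ {r} P[y]≈1 y =
          trans (eval-*ᴾ (prodUpTo G r) (G (suc r)) y) (trans (*-congʳ (P[y]≈1 y)) (*-identityˡ _))

      prodUpTo-degree0 : ∀ r → MonicFactors G dg r → Σ≤ dg r ≡ 0 →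
        ∀ y → eval (prodUpTo G r) y ≈ 1#
      prodUpTo-degree0 zero mG Σ≡0 =
        MonicOfDegree0-eval (≡.subst (MonicOfDegree (G 0)) Σ≡0 (mG 0 z≤n))
      prodUpTo-degree0 (suc r) mG Σ≡0 with Σ≤ dg r in S≡0 | dg (suc r) in d≡0
      prodUpTo-degree0 (suc r) mG _ | zero | zero =
        λ y → trans (times-unitʳ (MonicOfDegree0-eval (final mG d≡0)) y)
                    (prodUpTo-degree0 r (init mG) S≡0 y)

      prodUpTo-degree1 : ∀ r → MonicFactors G dg r → Σ≤ dg r ≡ 1 →
        ∃[ j ] (j ℕ.≤ r × MonicOfDegree (G j) 1 × ∀ y → eval (prodUpTo G r) y ≈ eval (G j) y)
      prodUpTo-degree1 zero mG Σ≡1 =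
        0 , z≤n , ≡.subst (MonicOfDegree (G 0)) Σ≡1 (mG 0 z≤n) , λ y → refl
      prodUpTo-degree1 (suc r) mG Σ≡1 with Σ≤ dg r in S≡ | dg (suc r) in d≡
      prodUpTo-degree1 (suc r) mG _ | 0 | 1 =
        suc r , ℕₚ.≤-refl , final mG d≡ , times-unitˡ (prodUpTo-degree0 r (init mG) S≡)
      prodUpTo-degree1 (suc r) mG _ | 1 | 0 with prodUpTo-degree1 r (init mG) S≡
      ... | j , j≤r , Gj-linear , P≈Gj =
        j , ℕₚ.m≤n⇒m≤1+n j≤r , Gj-linear ,
        λ y → trans (times-unitʳ (MonicOfDegree0-eval (final mG d≡)) y) (P≈Gj y)

      prodUpTo-degree2 : ∀ r → MonicFactors G dg r → Σ≤ dg r ≡ 2 →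
        (∃[ j ] (j ℕ.≤ r × ∀ y → eval (prodUpTo G r) y ≈ eval (G j) y)) ⊎
        (∃[ j ] ∃[ k ] (j ℕ.< k × k ℕ.≤ r × MonicOfDegree (G j) 1 × MonicOfDegree (G k) 1 ×
                        ∀ y → eval (prodUpTo G r) y ≈ eval (G j) y * eval (G k) y))
      prodUpTo-degree2 zero mG Σ≡2 = inj₁ (0 , z≤n , λ y → refl)
      prodUpTo-degree2 (suc r) mG Σ≡2 with Σ≤ dg r in S≡ | dg (suc r) in d≡
      prodUpTo-degree2 (suc r) mG _ | 0 | 2 =
        inj₁ (suc r , ℕₚ.≤-refl , times-unitˡ (prodUpTo-degree0 r (init mG) S≡))
      prodUpTo-degree2 (suc r) mG _ | 1 | 1 with prodUpTo-degree1 r (init mG) S≡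
      ... | j , j≤r , Gj-linear , P≈Gj =
        inj₂ (j , suc r , s≤s j≤r , ℕₚ.≤-refl , Gj-linear , final mG d≡ ,
              λ y → trans (eval-*ᴾ (prodUpTo G r) (G (suc r)) y) (*-congʳ (P≈Gj y)))
      prodUpTo-degree2 (suc r) mG _ | 2 | 0 with prodUpTo-degree2 r (init mG) S≡
      ... | inj₁ (j , j≤r , P≈Gj) =
        inj₁ (j , ℕₚ.m≤n⇒m≤1+n j≤r ,
              λ y → trans (times-unitʳ (MonicOfDegree0-eval (final mG d≡)) y) (P≈Gj y))
      ... | inj₂ (j , k , j<k , k≤r , Gj-linear , Gk-linear , P≈GjGk) =
        inj₂ (j , k , j<k , ℕₚ.m≤n⇒m≤1+n k≤r , Gj-linear , Gk-linear ,
              λ y → trans (times-unitʳ (MonicOfDegree0-eval (final mG d≡)) y) (P≈GjGk y))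

  module LucasSequences (P Q : ℤ) {α β : Carrier} (α+β≈P : α + β ≈ ⟦ P ⟧) (αβ≈Q : α * β ≈ ⟦ Q ⟧)
    where
    private
      distribute : ∀ p u q v d → (p * u - q * v) * d ≈ p * (u * d) - q * (v * d)
      distribute = solve 5 (λ p u q v d → (p :* u :- q :* v) :* d := p :* (u :* d) :- q :* (v :* d)) refl
      U-step : ∀ a b A B → (a + b) * (a * A - b * B) - a * b * (A - B) ≈ a * (a * A) - b * (b * B)
      U-step = solve 4 (λ a b A B → (a :+ b) :* (a :* A :- b :* B) :- a :* b :* (A :- B)
                                    := a :* (a :* A) :- b :* (b :* B)) refl
      V-step : ∀ a b A B → (a + b) * (a * A + b * B) - a * b * (A + B) ≈ a * (a * A) + b * (b * B)
      V-step = solve 4 (λ a b A B → (a :+ b) :* (a :* A :+ b :* B) :- a :* b :* (A :+ B)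
                                    := a :* (a :* A) :+ b :* (b :* B)) refl
      square-difference : ∀ a b → (a - b) * (a - b) ≈ (a + b) * (a + b) - ⟦ + 4 ⟧ * (a * b)
      square-difference =
        solve 2 (λ a b → (a :- b) :* (a :- b) := (a :+ b) :* (a :+ b) :- con (+ 4) :* (a :* b)) refl

    ⟦recurrence⟧ : ∀ a b → ⟦ P ℤ.* a ℤ.- Q ℤ.* b ⟧ ≈ (α + β) * ⟦ a ⟧ - α * β * ⟦ b ⟧
    ⟦recurrence⟧ a b = trans (⟦a-b⟧≈⟦a⟧-⟦b⟧ (P ℤ.* a) (Q ℤ.* b))
      (+-cong (trans (*-homo P a) (*-congʳ (sym α+β≈P)))
              (-‿cong (trans (*-homo Q b) (*-congʳ (sym αβ≈Q)))))

    U-Binet : ∀ k → ⟦ U P Q k ⟧ * (α - β) ≈ α ^ k - β ^ k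
    U-Binet zero = trans (*-congʳ 0-homo) (trans (zeroˡ _) (sym (-‿inverseʳ 1#)))
    U-Binet (suc zero) =
      trans (*-congʳ 1-homo)
        (trans (*-identityˡ _) (sym (+-cong (*-identityʳ α) (-‿cong (*-identityʳ β)))))
    U-Binet (suc (suc k)) = begin
      ⟦ P ℤ.* U P Q (suc k) ℤ.- Q ℤ.* U P Q k ⟧ * (α - β)
        ≈⟨ *-congʳ (⟦recurrence⟧ _ _) ⟩
      ((α + β) * ⟦ U P Q (suc k) ⟧ - α * β * ⟦ U P Q k ⟧) * (α - β)
        ≈⟨ distribute (α + β) _ (α * β) _ (α - β) ⟩
      (α + β) * (⟦ U P Q (suc k) ⟧ * (α - β)) - α * β * (⟦ U P Q k ⟧ * (α - β))
        ≈⟨ +-cong (*-congˡ (U-Binet (suc k))) (-‿cong (*-congˡ (U-Binet k))) ⟩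
      (α + β) * (α ^ suc k - β ^ suc k) - α * β * (α ^ k - β ^ k)
        ≈⟨ U-step α β (α ^ k) (β ^ k) ⟩
      α ^ suc (suc k) - β ^ suc (suc k)
        ∎

    V-Binet : ∀ k → ⟦ V P Q k ⟧ ≈ α ^ k + β ^ k
    V-Binet zero = trans (+-homo (+ 1) (+ 1)) (+-cong 1-homo 1-homo)
    V-Binet (suc zero) = trans (sym α+β≈P) (sym (+-cong (*-identityʳ α) (*-identityʳ β)))
    V-Binet (suc (suc k)) = begin
      ⟦ P ℤ.* V P Q (suc k) ℤ.- Q ℤ.* V P Q k ⟧                 ≈⟨ ⟦recurrence⟧ _ _ ⟩
      (α + β) * ⟦ V P Q (suc k) ⟧ - α * β * ⟦ V P Q k ⟧         ≈⟨ +-cong (*-congˡ (V-Binet (suc k)))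
                                                                          (-‿cong (*-congˡ (V-Binet k))) ⟩
      (α + β) * (α ^ suc k + β ^ suc k) - α * β * (α ^ k + β ^ k) ≈⟨ V-step α β (α ^ k) (β ^ k) ⟩
      α ^ suc (suc k) + β ^ suc (suc k)                          ∎

    [α-β]²≈Δ : (α - β) * (α - β) ≈ ⟦ P ℤ.* P ℤ.- + 4 ℤ.* Q ⟧
    [α-β]²≈Δ = begin
      (α - β) * (α - β)                           ≈⟨ square-difference α β ⟩
      (α + β) * (α + β) - ⟦ + 4 ⟧ * (α * β)       ≈⟨ +-cong (*-cong α+β≈P α+β≈P)
                                                             (-‿cong (*-congˡ αβ≈Q)) ⟩
      ⟦ P ⟧ * ⟦ P ⟧ - ⟦ + 4 ⟧ * ⟦ Q ⟧             ≈⟨ +-cong (*-homo P P) (-‿cong (*-homo (+ 4) Q)) ⟨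
      ⟦ P ℤ.* P ⟧ - ⟦ + 4 ℤ.* Q ⟧                 ≈⟨ ⟦a-b⟧≈⟦a⟧-⟦b⟧ (P ℤ.* P) (+ 4 ℤ.* Q) ⟨
      ⟦ P ℤ.* P ℤ.- + 4 ℤ.* Q ⟧                   ∎

module StrongFrobeniusToLucas {ℓ₁ ℓ₂} (R : CommutativeRing ℓ₁ ℓ₂)
  (hom : ℤ.+-*-rawRing -Raw-AlmostCommutative⟶ fromCommutativeRing R) where
  import Data.Nat.Properties as ℕₚ
  import Data.Nat.Divisibility as ℕᵈ
  import Data.Integer.Properties as ℤₚ
  import Relation.Binary.PropositionalEquality as ≡
  open ≡ using (_≡_)
  open import Relation.Nullary using (¬_)
  open import Data.Integer.Tactic.RingSolver using (solve-∀)
  open CommutativeRing R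
  open import Relation.Binary.Reasoning.Setoid setoid
  open import Algebra.Properties.Ring ring using (-0#≈0#; -‿distribʳ-*)
  open import Algebra.Properties.Semiring.Exp semiring using (_^_; ^-congˡ; ^-congʳ)
  open import Algebra.Properties.CommutativeSemiring.Exp commutativeSemiring using (^-distrib-*)
  open IntegerAlgebra R hom
  open Powers R
  open JacobiSymbol using (JacobiRel-transfer)
  open TwoAdic using (odd-*; n²∸1≡[n+1]*[n∸1]; 2-adic-decomposition; 2-adic-*; 2-adic-unique)

  module _ (n : ℕ) (1<n : 1 ℕ.< n) (n-odd : OddN n)
    (n∣⇒⟦⟧≈0 : ∀ {a} → + n Signed.∣ a → ⟦ a ⟧ ≈ 0#)
    (⟦⟧≈0⇒n∣ : ∀ {a} → ⟦ a ⟧ ≈ 0# → + n Signed.∣ a)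
    (P Q Q′ P⁻¹ Δ⁻¹ : ℤ)
    (PP⁻¹≡1 : + n Signed.∣ P ℤ.* P⁻¹ ℤ.- + 1)
    (QQ′≡1 : + n Signed.∣ Q ℤ.* Q′ ℤ.- + 1)
    (ΔΔ⁻¹≡1 : + n Signed.∣ (P ℤ.* P ℤ.- + 4 ℤ.* Q) ℤ.* Δ⁻¹ ℤ.- + 1)
    (X : Carrier) (X-root : X * X + ⟦ + 2 ℤ.- P ℤ.* P ℤ.* Q′ ⟧ * X + ⟦ + 1 ⟧ ≈ 0#) where
    open Modulo n n∣⇒⟦⟧≈0
    open MonicDegree n
    open Congruence n using (≡ₙ-refl; ≡ₙ-sym; ≡ₙ-trans)

    B : ℤ
    B = + 2 ℤ.- P ℤ.* P ℤ.* Q′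

    f : Poly
    f = quad B (+ 1)

    Δ : ℤ
    Δ = P ℤ.* P ℤ.- + 4 ℤ.* Q

    n∤2 : ¬ (+ n Signed.∣ + 2)
    n∤2 n∣2 with ℕₚ.≤-antisym (ℕᵈ.∣⇒≤ (Signed.∣⇒∣ᵤ n∣2)) 1<n
    ... | ≡.refl = n-odd ℕᵈ.∣-refl

    1≉-1 : ¬ (1# ≈ - 1#)
    1≉-1 1≈-1 =
      n∤2 (⟦⟧≈0⇒n∣ (trans (+-homo (+ 1) (+ 1))
                     (trans (+-cong (trans 1-homo 1≈-1) 1-homo) (-‿inverseˡ 1#))))

    private
      x-0≈x : ∀ {x y} → y ≈ 0# → x - y ≈ x
      x-0≈x {x} y≈0 = trans (+-congˡ (trans (-‿cong y≈0) -0#≈0#)) (+-identityʳ x)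

      x*1*1≈x : ∀ x → x * 1# * 1# ≈ x
      x*1*1≈x x = trans (*-identityʳ _) (*-identityʳ x)

    PP⁻¹≈1 : ⟦ P ⟧ * ⟦ P⁻¹ ⟧ ≈ 1#
    PP⁻¹≈1 = ⟦⟧-inverse PP⁻¹≡1

    QQ′≈1 : ⟦ Q ⟧ * ⟦ Q′ ⟧ ≈ 1#
    QQ′≈1 = ⟦⟧-inverse QQ′≡1

    ΔΔ⁻¹≈1 : ⟦ Δ ⟧ * ⟦ Δ⁻¹ ⟧ ≈ 1#
    ΔΔ⁻¹≈1 = ⟦⟧-inverse ΔΔ⁻¹≡1

    2-B≈P²Q′ : ⟦ + 2 ⟧ - ⟦ B ⟧ ≈ ⟦ P ⟧ * ⟦ P ⟧ * ⟦ Q′ ⟧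
    2-B≈P²Q′ = begin
      ⟦ + 2 ⟧ - ⟦ B ⟧                            ≈⟨ +-congˡ (-‿cong (⟦a-b⟧≈⟦a⟧-⟦b⟧ (+ 2) (P ℤ.* P ℤ.* Q′))) ⟩
      ⟦ + 2 ⟧ - (⟦ + 2 ⟧ - ⟦ P ℤ.* P ℤ.* Q′ ⟧)    ≈⟨ cancel ⟦ + 2 ⟧ _ ⟩
      ⟦ P ℤ.* P ℤ.* Q′ ⟧                         ≈⟨ trans (*-homo (P ℤ.* P) Q′) (*-congʳ (*-homo P P)) ⟩
      ⟦ P ⟧ * ⟦ P ⟧ * ⟦ Q′ ⟧                     ∎
      where
      cancel : ∀ a b → a - (a - b) ≈ b
      cancel = solve 2 (λ a b → a :- (a :- b) := b) refl

    -- α = β X and α + β = P determine α and β, because (X + 1)(1 - B - X) = 2 - B = P² Q′.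
    α β : Carrier
    α = ⟦ P⁻¹ ⟧ * ⟦ Q ⟧ * (X + ⟦ + 1 ⟧)
    β = ⟦ P⁻¹ ⟧ * ⟦ Q ⟧ * (⟦ + 1 ⟧ - ⟦ B ⟧ - X)

    α+β≈P : α + β ≈ ⟦ P ⟧
    α+β≈P = begin
      α + β                                        ≈⟨ collect ⟦ P⁻¹ ⟧ ⟦ Q ⟧ X ⟦ B ⟧ ⟩
      ⟦ P⁻¹ ⟧ * ⟦ Q ⟧ * (⟦ + 2 ⟧ - ⟦ B ⟧)          ≈⟨ *-congˡ 2-B≈P²Q′ ⟩
      ⟦ P⁻¹ ⟧ * ⟦ Q ⟧ * (⟦ P ⟧ * ⟦ P ⟧ * ⟦ Q′ ⟧)   ≈⟨ regroup ⟦ P ⟧ ⟦ P⁻¹ ⟧ ⟦ Q ⟧ ⟦ Q′ ⟧ ⟩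
      ⟦ P ⟧ * (⟦ P ⟧ * ⟦ P⁻¹ ⟧) * (⟦ Q ⟧ * ⟦ Q′ ⟧) ≈⟨ *-cong (*-congˡ PP⁻¹≈1) QQ′≈1 ⟩
      ⟦ P ⟧ * 1# * 1#                              ≈⟨ x*1*1≈x ⟦ P ⟧ ⟩
      ⟦ P ⟧                                        ∎
      where
      collect : ∀ p q x b →
        p * q * (x + ⟦ + 1 ⟧) + p * q * (⟦ + 1 ⟧ - b - x) ≈ p * q * (⟦ + 2 ⟧ - b)
      collect = solve 4 (λ p q x b → p :* q :* (x :+ con (+ 1)) :+ p :* q :* (con (+ 1) :- b :- x)
                                     := p :* q :* (con (+ 2) :- b)) refl
      regroup : ∀ p p⁻¹ q q′ → p⁻¹ * q * (p * p * q′) ≈ p * (p * p⁻¹) * (q * q′)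
      regroup = solve 4 (λ p p⁻¹ q q′ → p⁻¹ :* q :* (p :* p :* q′) := p :* (p :* p⁻¹) :* (q :* q′)) refl

    αβ≈Q : α * β ≈ ⟦ Q ⟧
    αβ≈Q = begin
      α * β
        ≈⟨ expand c X ⟦ B ⟧ ⟩
      c * c * (⟦ + 2 ⟧ - ⟦ B ⟧) - c * c * (X * X + ⟦ B ⟧ * X + ⟦ + 1 ⟧)
        ≈⟨ x-0≈x (trans (*-congˡ X-root) (zeroʳ _)) ⟩
      c * c * (⟦ + 2 ⟧ - ⟦ B ⟧)
        ≈⟨ *-congˡ 2-B≈P²Q′ ⟩
      c * c * (⟦ P ⟧ * ⟦ P ⟧ * ⟦ Q′ ⟧)
        ≈⟨ regroup ⟦ P ⟧ ⟦ P⁻¹ ⟧ ⟦ Q ⟧ ⟦ Q′ ⟧ ⟩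
      ⟦ Q ⟧ * (⟦ P ⟧ * ⟦ P⁻¹ ⟧) * (⟦ P ⟧ * ⟦ P⁻¹ ⟧) * (⟦ Q ⟧ * ⟦ Q′ ⟧)
        ≈⟨ *-cong (*-cong (*-congˡ PP⁻¹≈1) PP⁻¹≈1) QQ′≈1 ⟩
      ⟦ Q ⟧ * 1# * 1# * 1#
        ≈⟨ trans (*-identityʳ _) (x*1*1≈x ⟦ Q ⟧) ⟩
      ⟦ Q ⟧
        ∎
      where
      c : Carrier
      c = ⟦ P⁻¹ ⟧ * ⟦ Q ⟧
      expand : ∀ c x b → c * (x + ⟦ + 1 ⟧) * (c * (⟦ + 1 ⟧ - b - x))
                         ≈ c * c * (⟦ + 2 ⟧ - b) - c * c * (x * x + b * x + ⟦ + 1 ⟧)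
      expand = solve 3 (λ c x b → c :* (x :+ con (+ 1)) :* (c :* (con (+ 1) :- b :- x))
                                  := c :* c :* (con (+ 2) :- b)
                                     :- c :* c :* (x :* x :+ b :* x :+ con (+ 1))) refl
      regroup : ∀ p p⁻¹ q q′ →
        p⁻¹ * q * (p⁻¹ * q) * (p * p * q′) ≈ q * (p * p⁻¹) * (p * p⁻¹) * (q * q′)
      regroup = solve 4 (λ p p⁻¹ q q′ → p⁻¹ :* q :* (p⁻¹ :* q) :* (p :* p :* q′)
                                        := q :* (p :* p⁻¹) :* (p :* p⁻¹) :* (q :* q′)) refl

    α≈βX : α ≈ β * X
    α≈βX = sym (begin
      β * X                                                    ≈⟨ expand ⟦ P⁻¹ ⟧ ⟦ Q ⟧ X ⟦ B ⟧ ⟩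
      α - ⟦ P⁻¹ ⟧ * ⟦ Q ⟧ * (X * X + ⟦ B ⟧ * X + ⟦ + 1 ⟧)      ≈⟨ x-0≈x (trans (*-congˡ X-root)
                                                                             (zeroʳ _)) ⟩
      α                                                        ∎)
      where
      expand : ∀ p q x b →
        p * q * (⟦ + 1 ⟧ - b - x) * x ≈ p * q * (x + ⟦ + 1 ⟧) - p * q * (x * x + b * x + ⟦ + 1 ⟧)
      expand = solve 4 (λ p q x b → p :* q :* (con (+ 1) :- b :- x) :* x
                                    := p :* q :* (x :+ con (+ 1))
                                       :- p :* q :* (x :* x :+ b :* x :+ con (+ 1))) refl

    open LucasSequences P Q α+β≈P αβ≈Q

    X^s≈1⇒n∣U : ∀ {s} → X ^ s ≈ 1# → + n Signed.∣ U P Q s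
    X^s≈1⇒n∣U {s} X^s≈1 = ⟦⟧≈0⇒n∣ (begin
      ⟦ U P Q s ⟧                                   ≈⟨ *-identityʳ _ ⟨
      ⟦ U P Q s ⟧ * 1#                              ≈⟨ *-congˡ ΔΔ⁻¹≈1 ⟨
      ⟦ U P Q s ⟧ * (⟦ Δ ⟧ * ⟦ Δ⁻¹ ⟧)                ≈⟨ *-congˡ (*-congʳ [α-β]²≈Δ) ⟨
      ⟦ U P Q s ⟧ * ((α - β) * (α - β) * ⟦ Δ⁻¹ ⟧)    ≈⟨ reassociate _ _ _ ⟩
      ⟦ U P Q s ⟧ * (α - β) * ((α - β) * ⟦ Δ⁻¹ ⟧)    ≈⟨ *-congʳ (U-Binet s) ⟩
      (α ^ s - β ^ s) * ((α - β) * ⟦ Δ⁻¹ ⟧)          ≈⟨ *-congʳ (trans (+-congʳ α^s≈β^s)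
                                                                        (-‿inverseʳ _)) ⟩
      0# * ((α - β) * ⟦ Δ⁻¹ ⟧)                      ≈⟨ zeroˡ _ ⟩
      0#                                            ∎)
      where
      reassociate : ∀ u a d → u * (a * a * d) ≈ u * a * (a * d)
      reassociate = solve 3 (λ u a d → u :* (a :* a :* d) := u :* a :* (a :* d)) refl
      α^s≈β^s : α ^ s ≈ β ^ s
      α^s≈β^s = begin
        α ^ s          ≈⟨ ^-congˡ s α≈βX ⟩
        (β * X) ^ s    ≈⟨ ^-distrib-* β X s ⟩
        β ^ s * X ^ s  ≈⟨ *-congˡ X^s≈1 ⟩
        β ^ s * 1#     ≈⟨ *-identityʳ _ ⟩
        β ^ s          ∎

    X^e≈-1⇒n∣V : ∀ {e} → X ^ e ≈ - 1# → + n Signed.∣ V P Q e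
    X^e≈-1⇒n∣V {e} X^e≈-1 = ⟦⟧≈0⇒n∣ (begin
      ⟦ V P Q e ⟧               ≈⟨ V-Binet e ⟩
      α ^ e + β ^ e             ≈⟨ +-congʳ (^-congˡ e α≈βX) ⟩
      (β * X) ^ e + β ^ e       ≈⟨ +-congʳ (^-distrib-* β X e) ⟩
      β ^ e * X ^ e + β ^ e     ≈⟨ +-congʳ (*-congˡ X^e≈-1) ⟩
      β ^ e * - 1# + β ^ e      ≈⟨ +-congʳ (trans (sym (-‿distribʳ-* _ 1#))
                                                  (-‿cong (*-identityʳ _))) ⟩
      - β ^ e + β ^ e           ≈⟨ -‿inverseˡ _ ⟩
      0#                        ∎)

    StrongLucasDivisibility : ℕ → ℕ → Set
    StrongLucasDivisibility r s =
      (+ n Unsigned.∣ U P Q s) ⊎ ∃[ t ] (t ℕ.< r × + n Unsigned.∣ V P Q (2 ℕ.^ t ℕ.* s))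

    StrongLucasCondition : ℤ → Set
    StrongLucasCondition ε =
      ∃[ r ] ∃[ s ] (OddN s × (+ n ≡ + (2 ℕ.^ r ℕ.* s) ℤ.+ ε) × StrongLucasDivisibility r s)

    FactorRoot⇒StrongLucas : ∀ {r s j} → j ℕ.≤ r → FactorRoot s j X → StrongLucasDivisibility r s
    FactorRoot⇒StrongLucas {s = s} {zero} _ X^s≈1 =
      inj₁ (Signed.∣⇒∣ᵤ (X^s≈1⇒n∣U {s} X^s≈1))
    FactorRoot⇒StrongLucas {s = s} {suc t} t<r X^2^t*s≈-1 =
      inj₂ (t , t<r , Signed.∣⇒∣ᵤ (X^e≈-1⇒n∣V {2 ℕ.^ t ℕ.* s} X^2^t*s≈-1))

    eval-f : ∀ y → eval f y ≈ (y - X) * (y + ⟦ B ⟧ + X)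
    eval-f y = begin
      ⟦ + 1 ⟧ + y * (⟦ B ⟧ + y * (⟦ + 1 ⟧ + y * 0#))              ≈⟨ +-congˡ (*-congˡ (+-congˡ
                                                                      (*-congˡ (eval-constᴾ (+ 1) y)))) ⟩
      ⟦ + 1 ⟧ + y * (⟦ B ⟧ + y * ⟦ + 1 ⟧)                         ≈⟨ factor y ⟦ B ⟧ X ⟩
      (y - X) * (y + ⟦ B ⟧ + X) + (X * X + ⟦ B ⟧ * X + ⟦ + 1 ⟧)   ≈⟨ +-congˡ X-root ⟩
      (y - X) * (y + ⟦ B ⟧ + X) + 0#                              ≈⟨ +-identityʳ _ ⟩
      (y - X) * (y + ⟦ B ⟧ + X)                                   ∎
      where
      factor : ∀ y b x →
        ⟦ + 1 ⟧ + y * (b + y * ⟦ + 1 ⟧) ≈ (y - x) * (y + b + x) + (x * x + b * x + ⟦ + 1 ⟧)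
      factor = solve 3 (λ y b x → con (+ 1) :+ y :* (b :+ y :* con (+ 1))
                                  := (y :- x) :* (y :+ b :+ x) :+ (x :* x :+ b :* x :+ con (+ 1))) refl

    f[X]≈0 : eval f X ≈ 0#
    f[X]≈0 = trans (eval-f X) (trans (*-congʳ (-‿inverseʳ X)) (zeroˡ _))

    f[0]≈1 : eval f 0# ≈ 1#
    f[0]≈1 = trans (+-congˡ (zeroˡ _)) (trans (+-identityʳ _) 1-homo)

    -- The roots -a and -b of such a product are mutually inverse, since f(0) = 1.
    f≉distinct-linear-factors : ∀ {s j k Gⱼ Gₖ} → j ℕ.< k →
      (∀ {y} → eval Gⱼ y ≈ 0# → FactorRoot s j y) → (∀ {y} → eval Gₖ y ≈ 0# → FactorRoot s k y) →
      MonicOfDegree Gⱼ 1 → MonicOfDegree Gₖ 1 → ¬ (∀ y → eval f y ≈ eval Gⱼ y * eval Gₖ y)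
    f≉distinct-linear-factors {Gⱼ = Gⱼ} {Gₖ} j<k Gⱼ-root Gₖ-root Gⱼ-linear Gₖ-linear f≈GⱼGₖ
      with MonicOfDegree1-eval Gⱼ-linear | MonicOfDegree1-eval Gₖ-linear
    ... | a , Gⱼ≈a+y | b , Gₖ≈b+y =
      FactorRoot-inverses 1≉-1 (Gⱼ-root (trans (Gⱼ≈a+y _) (-‿inverseʳ _)))
                               (Gₖ-root (trans (Gₖ≈b+y _) (-‿inverseʳ _))) [-a][-b]≈1 j<k
      where
      neg*neg : ∀ x y → - x * - y ≈ x * y
      neg*neg = solve 2 (λ x y → :- x :* :- y := x :* y) refl
      [-a][-b]≈1 : - ⟦ a ⟧ * - ⟦ b ⟧ ≈ 1#
      [-a][-b]≈1 = begin
        - ⟦ a ⟧ * - ⟦ b ⟧            ≈⟨ neg*neg ⟦ a ⟧ ⟦ b ⟧ ⟩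
        ⟦ a ⟧ * ⟦ b ⟧                ≈⟨ *-cong (+-identityʳ _) (+-identityʳ _) ⟨
        (⟦ a ⟧ + 0#) * (⟦ b ⟧ + 0#)  ≈⟨ *-cong (Gⱼ≈a+y 0#) (Gₖ≈b+y 0#) ⟨
        eval Gⱼ 0# * eval Gₖ 0#      ≈⟨ f≈GⱼGₖ 0# ⟨
        eval f 0#                    ≈⟨ f[0]≈1 ⟩
        1#                           ∎

    SquareRootFactors : Poly → ℕ → ℕ → (ℕ → Poly) → Set
    SquareRootFactors F r s G =
      IsGcmd n F (monoᴾ s -ᴾ constᴾ (+ 1)) (G 0) ×
      (∀ j → 1 ℕ.≤ j → j ℕ.≤ r → IsGcmd n F (monoᴾ (2 ℕ.^ (j ℕ.∸ 1) ℕ.* s) +ᴾ constᴾ (+ 1)) (G j))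

    SquareRootFactors-monic : ∀ {F r s G} → SquareRootFactors F r s G →
      MonicFactors G (λ j → deg (G j)) r
    SquareRootFactors-monic {G = G} (G₀-gcmd , _) zero _ = Monic⇒MonicOfDegree (G 0) (proj₁ G₀-gcmd)
    SquareRootFactors-monic {G = G} (_ , Gⱼ-gcmd) (suc t) t<r =
      Monic⇒MonicOfDegree (G (suc t)) (proj₁ (Gⱼ-gcmd (suc t) (s≤s z≤n) t<r))

    SquareRootFactors-root : ∀ {F r s G} → SquareRootFactors F r s G →
      ∀ j → j ℕ.≤ r → ∀ {y} → eval (G j) y ≈ 0# → FactorRoot s j y
    SquareRootFactors-root {s = s} (G₀-gcmd , _) zero _ {y} G₀[y]≈0 =
      eval-xᵏ-1≈0⇒yᵏ≈1 s y (IsGcmd-root G₀-gcmd G₀[y]≈0)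
    SquareRootFactors-root {s = s} (_ , Gⱼ-gcmd) (suc t) t<r {y} Gⱼ[y]≈0 =
      eval-xᵏ+1≈0⇒yᵏ≈-1 (2 ℕ.^ t ℕ.* s) y (IsGcmd-root (Gⱼ-gcmd (suc t) (s≤s z≤n) t<r) Gⱼ[y]≈0)

    SquareRootFactors-degree : ∀ {F d r s G} → SquareRootFactors F r s G → MonicOfDegree F d →
      F ≈[ n ] prodUpTo G r → d ≡ Σ≤ (λ j → deg (G j)) r
    SquareRootFactors-degree {F} {r = r} {G = G} factors F-monic F≈∏G =
      MonicOfDegree-unique 1<n F-monic (prodUpTo-MonicOfDegree r (SquareRootFactors-monic factors))
        (≈[n]⇒coeff≡ₙ F (prodUpTo G r) F≈∏G)

    SquareRootFactors-FactorRoot : ∀ {F r s G} → SquareRootFactors F r s G →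
      F ≈[ n ] prodUpTo G r → MonicOfDegree F 2 → (∀ y → eval F y ≈ eval f y) →
      ∃[ j ] (j ℕ.≤ r × FactorRoot s j X)
    SquareRootFactors-FactorRoot {F} {r} {s} {G} factors F≈∏G F-monic F≗f =
      [ (λ (j , j≤r , ∏≈Gⱼ) → j , j≤r , root j j≤r (begin
          eval (G j) X              ≈⟨ ∏≈Gⱼ X ⟨
          eval (prodUpTo G r) X     ≈⟨ f≗∏G X ⟨
          eval f X                  ≈⟨ f[X]≈0 ⟩
          0#                        ∎))
      , (λ (j , k , j<k , k≤r , Gⱼ-linear , Gₖ-linear , ∏≈GⱼGₖ) →
          ⊥-elim (f≉distinct-linear-factors j<k (root j (ℕₚ.<⇒≤ (ℕₚ.<-≤-trans j<k k≤r)))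
                    (root k k≤r) Gⱼ-linear Gₖ-linear (λ y → trans (f≗∏G y) (∏≈GⱼGₖ y))))
      ]′ (prodUpTo-degree2 r (SquareRootFactors-monic factors)
            (≡.sym (SquareRootFactors-degree factors F-monic F≈∏G)))
      where
      root : ∀ j → j ℕ.≤ r → ∀ {y} → eval (G j) y ≈ 0# → FactorRoot s j y
      root = SquareRootFactors-root factors
      f≗∏G : ∀ y → eval f y ≈ eval (prodUpTo G r) y
      f≗∏G y = trans (sym (F≗f y)) (eval-≈[n] F (prodUpTo G r) y F≈∏G)

    FrobeniusData₂ : (ℕ → Poly) → Set
    FrobeniusData₂ = FrobeniusData n 2 f (discQuad B (+ 1))

    F-monic : ∀ {F} → FrobeniusData₂ F → ∀ i → 1 ℕ.≤ i → i ℕ.≤ 2 →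
      MonicOfDegree (F i) (deg (F i))
    F-monic {F} ((_ , _ , factor , _) , _) i 1≤i i≤2 =
      Monic⇒MonicOfDegree (F i) (proj₁ (proj₁ (factor i 1≤i i≤2)))

    F-monicOfDegree : ∀ {F} → FrobeniusData₂ F → ∀ {i d} → 1 ℕ.≤ i → i ℕ.≤ 2 → deg (F i) ≡ d →
      MonicOfDegree (F i) d
    F-monicOfDegree {F} frobenius {i} 1≤i i≤2 ≡.refl = F-monic frobenius i 1≤i i≤2

    F-factorisation : ∀ {F} → FrobeniusData₂ F →
      deg (F 1) ℕ.+ deg (F 2) ≡ 2 × (∀ y → eval f y ≈ eval (F 1) y * eval (F 2) y)
    F-factorisation {F} frobenius@((fs , fs₀≈f , factor , fs₂≈1) , _)
      with factor 1 (s≤s z≤n) (s≤s z≤n) | factor 2 (s≤s z≤n) (s≤s (s≤s z≤n))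
    ... | _ , fs₁-monic , fs₀≈F₁fs₁ | _ , fs₂-monic , fs₁≈F₂fs₂ = degrees , product
      where
      F₁-monic : MonicOfDegree (F 1) (deg (F 1))
      F₁-monic = F-monic frobenius 1 (s≤s z≤n) (s≤s z≤n)
      F₂-monic : MonicOfDegree (F 2) (deg (F 2))
      F₂-monic = F-monic frobenius 2 (s≤s z≤n) ℕₚ.≤-refl
      deg-fs₂ : deg (fs 2) ≡ 0
      deg-fs₂ = MonicOfDegree-unique 1<n (Monic⇒MonicOfDegree (fs 2) fs₂-monic) (lead ≡ₙ-refl)
                  (≈[n]⇒coeff≡ₙ (fs 2) (constᴾ (+ 1)) fs₂≈1)
      deg-fs₁ : deg (fs 1) ≡ deg (F 2) ℕ.+ deg (fs 2)
      deg-fs₁ = MonicOfDegree-unique 1<n (Monic⇒MonicOfDegree (fs 1) fs₁-monic)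
                  (*ᴾ-MonicOfDegree F₂-monic (Monic⇒MonicOfDegree (fs 2) fs₂-monic))
                  (≈[n]⇒coeff≡ₙ (fs 1) _ fs₁≈F₂fs₂)
      deg-f : 2 ≡ deg (F 1) ℕ.+ deg (fs 1)
      deg-f = MonicOfDegree-unique 1<n (cons _ (cons _ (lead ≡ₙ-refl)))
                (*ᴾ-MonicOfDegree F₁-monic (Monic⇒MonicOfDegree (fs 1) fs₁-monic))
                (λ k → ≡ₙ-trans (≡ₙ-sym (≈[n]⇒coeff≡ₙ (fs 0) f fs₀≈f k))
                                (≈[n]⇒coeff≡ₙ (fs 0) _ fs₀≈F₁fs₁ k))
      degrees : deg (F 1) ℕ.+ deg (F 2) ≡ 2
      degrees = ≡.sym (≡.trans deg-f (≡.cong (deg (F 1) ℕ.+_)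
                  (≡.trans deg-fs₁ (≡.trans (≡.cong (deg (F 2) ℕ.+_) deg-fs₂) (ℕₚ.+-identityʳ _)))))
      product : ∀ y → eval f y ≈ eval (F 1) y * eval (F 2) y
      product y = begin
        eval f y                                    ≈⟨ eval-≈[n] (fs 0) f y fs₀≈f ⟨
        eval (fs 0) y                               ≈⟨ eval-≈[n] (fs 0) _ y fs₀≈F₁fs₁ ⟩
        eval (F 1 *ᴾ fs 1) y                        ≈⟨ eval-*ᴾ (F 1) (fs 1) y ⟩
        eval (F 1) y * eval (fs 1) y                ≈⟨ *-congˡ (eval-≈[n] (fs 1) _ y fs₁≈F₂fs₂) ⟩
        eval (F 1) y * eval (F 2 *ᴾ fs 2) y         ≈⟨ *-congˡ (eval-*ᴾ (F 2) (fs 2) y) ⟩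
        eval (F 1) y * (eval (F 2) y * eval (fs 2) y) ≈⟨ *-congˡ (*-congˡ fs₂[y]≈1) ⟩
        eval (F 1) y * (eval (F 2) y * 1#)          ≈⟨ *-congˡ (*-identityʳ _) ⟩
        eval (F 1) y * eval (F 2) y                 ∎
        where
        fs₂[y]≈1 : eval (fs 2) y ≈ 1#
        fs₂[y]≈1 =
          trans (eval-≈[n] (fs 2) (constᴾ (+ 1)) y fs₂≈1) (trans (eval-constᴾ (+ 1) y) 1-homo)

    F₁≗f : ∀ {F} → FrobeniusData₂ F → deg (F 2) ≡ 0 → ∀ y → eval (F 1) y ≈ eval f y
    F₁≗f {F} frobenius d₂≡0 y = sym (begin
      eval f y                      ≈⟨ proj₂ (F-factorisation frobenius) y ⟩
      eval (F 1) y * eval (F 2) y   ≈⟨ *-congˡ (MonicOfDegree0-eval F₂-constant y) ⟩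
      eval (F 1) y * 1#             ≈⟨ *-identityʳ _ ⟩
      eval (F 1) y                  ∎)
      where
      F₂-constant : MonicOfDegree (F 2) 0
      F₂-constant = F-monicOfDegree frobenius (s≤s z≤n) ℕₚ.≤-refl d₂≡0

    F₂≗f : ∀ {F} → FrobeniusData₂ F → deg (F 1) ≡ 0 → ∀ y → eval (F 2) y ≈ eval f y
    F₂≗f {F} frobenius d₁≡0 y = sym (begin
      eval f y                      ≈⟨ proj₂ (F-factorisation frobenius) y ⟩
      eval (F 1) y * eval (F 2) y   ≈⟨ *-congʳ (MonicOfDegree0-eval F₁-constant y) ⟩
      1# * eval (F 2) y             ≈⟨ *-identityˡ _ ⟩
      eval (F 2) y                  ∎)
      where
      F₁-constant : MonicOfDegree (F 1) 0
      F₁-constant = F-monicOfDegree frobenius (s≤s z≤n) (s≤s z≤n) d₁≡0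

    X*y≈1 : ∀ {y} → y + ⟦ B ⟧ + X ≈ 0# → X * y ≈ 1#
    X*y≈1 {y} y+B+X≈0 = begin
      X * y
        ≈⟨ expand X y ⟦ B ⟧ ⟩
      X * (y + ⟦ B ⟧ + X) - (X * X + ⟦ B ⟧ * X + ⟦ + 1 ⟧) + ⟦ + 1 ⟧
        ≈⟨ +-cong (+-cong X[y+B+X]≈0 (-‿cong X-root)) 1-homo ⟩
      0# - 0# + 1#
        ≈⟨ trans (+-congʳ (-‿inverseʳ 0#)) (+-identityˡ 1#) ⟩
      1#
        ∎
      where
      expand : ∀ x y b → x * y ≈ x * (y + b + x) - (x * x + b * x + ⟦ + 1 ⟧) + ⟦ + 1 ⟧
      expand = solve 3 (λ x y b → x :* y := x :* (y :+ b :+ x) :- (x :* x :+ b :* x :+ con (+ 1))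
                                            :+ con (+ 1)) refl
      X[y+B+X]≈0 : X * (y + ⟦ B ⟧ + X) ≈ 0#
      X[y+B+X]≈0 = trans (*-congˡ y+B+X≈0) (zeroʳ X)

    Xⁿ-X-invertible : ∀ {F} → FrobeniusData₂ F → deg (F 1) ≡ 0 → ∃[ u ] u * (X ^ n - X) ≈ 1#
    Xⁿ-X-invertible {F} frobenius@((fs , fs₀≈f , factor , _) , _) d₁≡0 =
      let a , b , a[xⁿ-x]+b·fs₀≈F₁ = IsGcmd-Bézout (proj₁ (factor 1 (s≤s z≤n) (s≤s z≤n)))
      in eval a X , (begin
        eval a X * (X ^ n - X)
          ≈⟨ +-identityʳ _ ⟨
        eval a X * (X ^ n - X) + 0#
          ≈⟨ +-cong (*-congˡ xⁿ-x[X]≈Xⁿ-X) (trans (*-congˡ fs₀[X]≈0) (zeroʳ _)) ⟨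
        eval a X * eval (monoᴾ (n ℕ.^ 1) -ᴾ monoᴾ 1) X + eval b X * eval (fs 0) X
          ≈⟨ a[xⁿ-x]+b·fs₀≈F₁ X ⟩
        eval (F 1) X
          ≈⟨ MonicOfDegree0-eval (F-monicOfDegree frobenius (s≤s z≤n) (s≤s z≤n) d₁≡0) X ⟩
        1#
          ∎)
      where
      xⁿ-x[X]≈Xⁿ-X : eval (monoᴾ (n ℕ.^ 1) -ᴾ monoᴾ 1) X ≈ X ^ n - X
      xⁿ-x[X]≈Xⁿ-X = trans (eval-minusᴾ (monoᴾ (n ℕ.^ 1)) (monoᴾ 1) X)
        (+-cong (trans (eval-monoᴾ (n ℕ.^ 1) X) (^-congʳ X (ℕₚ.*-identityʳ n)))
                (-‿cong (trans (eval-monoᴾ 1 X) (*-identityʳ X))))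
      fs₀[X]≈0 : eval (fs 0) X ≈ 0#
      fs₀[X]≈0 = trans (eval-≈[n] (fs 0) f X fs₀≈f) f[X]≈0

    f[Xⁿ]≈0 : ∀ {F} → FrobeniusData₂ F → deg (F 1) ≡ 0 → eval f (X ^ n) ≈ 0#
    f[Xⁿ]≈0 {F} frobenius@(_ , frobenius-step , _) d₁≡0 =
      let c , F₂[xⁿ]≈c·F₂ = frobenius-step 2 (s≤s (s≤s z≤n)) ℕₚ.≤-refl
      in begin
        eval f (X ^ n)                      ≈⟨ F₂≗f frobenius d₁≡0 (X ^ n) ⟨
        eval (F 2) (X ^ n)                  ≈⟨ eval-congʳ (F 2) (eval-monoᴾ n X) ⟨
        eval (F 2) (eval (monoᴾ n) X)       ≈⟨ eval-composeᴾ (F 2) (monoᴾ n) X ⟨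
        eval (composeᴾ (F 2) (monoᴾ n)) X   ≈⟨ divisor-root _ c (F 2) F₂[xⁿ]≈c·F₂
                                                   (trans (F₂≗f frobenius d₁≡0 X) f[X]≈0) ⟩
        0#                                  ∎

    -- When F₁ = 1, the Frobenius step makes Xⁿ a root of f distinct from X, i.e. Xⁿ = X⁻¹.
    X^[n+1]≈1 : ∀ {F} → FrobeniusData₂ F → deg (F 1) ≡ 0 → X ^ suc n ≈ 1#
    X^[n+1]≈1 frobenius d₁≡0 =
      let u , u[Xⁿ-X]≈1 = Xⁿ-X-invertible frobenius d₁≡0
      in X*y≈1 (begin
        X ^ n + ⟦ B ⟧ + X                         ≈⟨ *-identityˡ _ ⟨
        1# * (X ^ n + ⟦ B ⟧ + X)                  ≈⟨ *-congʳ u[Xⁿ-X]≈1 ⟨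
        u * (X ^ n - X) * (X ^ n + ⟦ B ⟧ + X)      ≈⟨ *-assoc _ _ _ ⟩
        u * ((X ^ n - X) * (X ^ n + ⟦ B ⟧ + X))    ≈⟨ *-congˡ (trans (sym (eval-f (X ^ n)))
                                                                  (f[Xⁿ]≈0 frobenius d₁≡0)) ⟩
        u * 0#                                    ≈⟨ zeroʳ u ⟩
        0#                                        ∎)

    Δf≡[PQ′]²Δ : + n Signed.∣ discQuad B (+ 1) ℤ.- P ℤ.* Q′ ℤ.* (P ℤ.* Q′) ℤ.* Δ
    Δf≡[PQ′]²Δ =
      ≡.subst (+ n Signed.∣_) (≡.sym (expand P Q Q′)) (Signed.∣n⇒∣m*n (+ 4 ℤ.* P ℤ.* P ℤ.* Q′) QQ′≡1)
      where
      expand : ∀ P Q Q′ → (+ 2 ℤ.- P ℤ.* P ℤ.* Q′) ℤ.* (+ 2 ℤ.- P ℤ.* P ℤ.* Q′) ℤ.- + 4 ℤ.* + 1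
                           ℤ.- P ℤ.* Q′ ℤ.* (P ℤ.* Q′) ℤ.* (P ℤ.* P ℤ.- + 4 ℤ.* Q)
                         ≡ + 4 ℤ.* P ℤ.* P ℤ.* Q′ ℤ.* (Q ℤ.* Q′ ℤ.- + 1)
      expand = solve-∀

    [PQ′][P⁻¹Q]≡1 : + n Signed.∣ P ℤ.* Q′ ℤ.* (P⁻¹ ℤ.* Q) ℤ.- + 1
    [PQ′][P⁻¹Q]≡1 = ≡.subst (+ n Signed.∣_) (≡.sym (expand P Q Q′ P⁻¹))
      (Signed.∣m∣n⇒∣m+n (Signed.∣m⇒∣m*n (Q ℤ.* Q′) PP⁻¹≡1) QQ′≡1)
      where
      expand : ∀ P Q Q′ P⁻¹ → P ℤ.* Q′ ℤ.* (P⁻¹ ℤ.* Q) ℤ.- + 1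
                              ≡ (P ℤ.* P⁻¹ ℤ.- + 1) ℤ.* (Q ℤ.* Q′) ℤ.+ (Q ℤ.* Q′ ℤ.- + 1)
      expand = solve-∀

    jacobi : ∀ {F} → FrobeniusData₂ F → ∀ {d} → deg (F 2) ≡ d →
      JacobiRel Δ n ((ℤ.- + 1) ℤ.^ (d ℕ./ 2))
    jacobi (_ , _ , _ , jacobiΔf , -1^S≡j) ≡.refl =
      JacobiRel-transfer {k = P ℤ.* Q′} {P⁻¹ ℤ.* Q} Δf≡[PQ′]²Δ [PQ′][P⁻¹Q]≡1
        (≡.subst (JacobiRel _ n) (≡.sym -1^S≡j) jacobiΔf)

    split-case : ∀ {F} → FrobeniusData₂ F → SquareRootStep n 2 F →
      deg (F 1) ≡ 2 → deg (F 2) ≡ 0 → StrongLucasCondition (+ 1)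
    split-case {F} frobenius squareRoots d₁≡2 d₂≡0 =
      let r , s , s-odd , n¹-1≡2^r*s , G , G₀-gcmd , Gⱼ-gcmd , F₁≈∏G , _ =
            squareRoots 1 (s≤s z≤n) (s≤s z≤n)
          j , j≤r , root = SquareRootFactors-FactorRoot (G₀-gcmd , Gⱼ-gcmd) F₁≈∏G
            (F-monicOfDegree frobenius (s≤s z≤n) (s≤s z≤n) d₁≡2) (F₁≗f frobenius d₂≡0)
      in r , s , s-odd , n≡2^r*s+1 {r} {s} n¹-1≡2^r*s , FactorRoot⇒StrongLucas {r} {s} j≤r root
      where
      n≡2^r*s+1 : ∀ {r s} → n ℕ.^ 1 ℕ.∸ 1 ≡ 2 ℕ.^ r ℕ.* s → + n ≡ + (2 ℕ.^ r ℕ.* s) ℤ.+ + 1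
      n≡2^r*s+1 {r} {s} n¹-1≡2^r*s =
        ≡.trans (≡.cong +_ (≡.trans (≡.sym (ℕₚ.m∸n+n≡m (ℕₚ.<⇒≤ 1<n)))
          (≡.cong (ℕ._+ 1) (≡.trans (≡.cong (ℕ._∸ 1) (≡.sym (ℕₚ.*-identityʳ n))) n¹-1≡2^r*s))))
          (ℤₚ.pos-+ (2 ℕ.^ r ℕ.* s) 1)

    -- n² - 1 = (n + 1)(n - 1): the square root step for F₂ controls the odd part s m of n² - 1,
    -- and X^(n+1) = 1 reduces it to the odd part s of n + 1.
    inert-FactorRoot : ∀ {F} → FrobeniusData₂ F → SquareRootStep n 2 F →
      deg (F 1) ≡ 0 → deg (F 2) ≡ 2 →
      ∀ {r s} → OddN s → suc n ≡ 2 ℕ.^ r ℕ.* s → ∃[ j ] (j ℕ.≤ r × FactorRoot s j X)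
    inert-FactorRoot {F} frobenius squareRoots d₁≡0 d₂≡2 {r} {s} s-odd n+1≡2^r*s =
      let r′ , s′ , s′-odd , n²-1≡2^r′*s′ , G , G₀-gcmd , Gⱼ-gcmd , F₂≈∏G , _ =
            squareRoots 2 (s≤s z≤n) ℕₚ.≤-refl
          r₂ , m , m-odd , n-1≡2^r₂*m = 2-adic-decomposition (n ℕ.∸ 1) (ℕₚ.m<n⇒0<n∸m 1<n)
          n²-1≡2^[r+r₂]*sm : n ℕ.^ 2 ℕ.∸ 1 ≡ 2 ℕ.^ (r ℕ.+ r₂) ℕ.* (s ℕ.* m)
          n²-1≡2^[r+r₂]*sm = ≡.trans (n²∸1≡[n+1]*[n∸1] (ℕₚ.<⇒≤ 1<n))
                               (2-adic-* {r = r} {s} {r₂} {m} n+1≡2^r*s n-1≡2^r₂*m)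
          _ , s′≡s*m = 2-adic-unique r′ (r ℕ.+ r₂) s′-odd (odd-* s-odd m-odd)
            (≡.trans (≡.sym n²-1≡2^r′*s′) n²-1≡2^[r+r₂]*sm)
          j , _ , root = SquareRootFactors-FactorRoot (G₀-gcmd , Gⱼ-gcmd) F₂≈∏G
            (F-monicOfDegree frobenius (s≤s z≤n) ℕₚ.≤-refl d₂≡2) (F₂≗f frobenius d₁≡0)
      in j , FactorRoot-oddPart 1≉-1 m-odd
               (trans (^-congʳ X (≡.sym n+1≡2^r*s)) (X^[n+1]≈1 frobenius d₁≡0))
               (≡.subst (λ e → FactorRoot e j X) s′≡s*m root)

    inert-case : ∀ {F} → FrobeniusData₂ F → SquareRootStep n 2 F →
      deg (F 1) ≡ 0 → deg (F 2) ≡ 2 → StrongLucasCondition (ℤ.- + 1)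
    inert-case frobenius squareRoots d₁≡0 d₂≡2 =
      let r , s , s-odd , n+1≡2^r*s = 2-adic-decomposition (suc n) (s≤s z≤n)
          j , j≤r , root = inert-FactorRoot frobenius squareRoots d₁≡0 d₂≡2 s-odd n+1≡2^r*s
      in r , s , s-odd , ≡.subst (λ t → + n ≡ + t ℤ.+ ℤ.- + 1) n+1≡2^r*s ≡.refl ,
         FactorRoot⇒StrongLucas {r} {s} j≤r root

    F₂-not-linear : ∀ {F} → FrobeniusData₂ F → SquareRootStep n 2 F → ¬ (deg (F 2) ≡ 1)
    F₂-not-linear frobenius squareRoots d₂≡1 =
      let r , _ , _ , _ , _ , G₀-gcmd , Gⱼ-gcmd , F₂≈∏G , 2∣deg-G = squareRoots 2 (s≤s z≤n) ℕₚ.≤-refl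
      in 2∤1 (≡.subst (2 ℕᵈ.∣_)
               (≡.sym (SquareRootFactors-degree (G₀-gcmd , Gⱼ-gcmd)
                        (F-monicOfDegree frobenius (s≤s z≤n) ℕₚ.≤-refl d₂≡1) F₂≈∏G))
               (Σ≤-∣ r 2∣deg-G))
      where
      2∤1 : ¬ (2 ℕᵈ.∣ 1)
      2∤1 2∣1 with ℕᵈ.∣⇒≤ 2∣1
      ... | s≤s ()

    strong-lucas : ∀ {F} → FrobeniusData₂ F → SquareRootStep n 2 F →
      ∃[ ε ] (JacobiRel Δ n ε × StrongLucasCondition ε)
    strong-lucas {F} frobenius squareRoots =
      by-degrees (deg (F 1)) (deg (F 2)) ≡.refl ≡.refl (proj₁ (F-factorisation frobenius))
      where
      by-degrees : ∀ d₁ d₂ → deg (F 1) ≡ d₁ → deg (F 2) ≡ d₂ → d₁ ℕ.+ d₂ ≡ 2 →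
        ∃[ ε ] (JacobiRel Δ n ε × StrongLucasCondition ε)
      by-degrees 2 0 d₁≡2 d₂≡0 _ =
        + 1 , jacobi frobenius d₂≡0 , split-case frobenius squareRoots d₁≡2 d₂≡0
      by-degrees 0 2 d₁≡0 d₂≡2 _ =
        ℤ.- + 1 , jacobi frobenius d₂≡2 , inert-case frobenius squareRoots d₁≡0 d₂≡2
      by-degrees 1 1 _ d₂≡1 _ = ⊥-elim (F₂-not-linear frobenius squareRoots d₂≡1)

open import Data.Nat.Coprimality using (Coprime)
open import Data.Integer using (_+_; _-_; _*_; ∣_∣)
open import Data.Integer.Divisibility using (_∣_)
open import Data.Integer.Tactic.RingSolver using (solve-∀)
open import Relation.Binary.PropositionalEquality using (_≡_; subst)
open ModularInverse using (inverse-of-factor)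

private
  Δf-factorisation : ∀ P Q′ → + 1 * ((+ 2 - P * P * Q′) * (+ 2 - P * P * Q′) - + 4 * + 1)
                              ≡ P * (P * Q′ * (P * P * Q′ - + 4))
  Δf-factorisation = solve-∀

  2ΔQ-factorisation : ∀ P Q → + 2 * (P * P - + 4 * Q) * Q ≡ (P * P - + 4 * Q) * (+ 2 * Q)
  2ΔQ-factorisation = solve-∀

  2ΔQ≡2QΔ : ∀ P Q → + 2 * (P * P - + 4 * Q) * Q ≡ + 2 * Q * (P * P - + 4 * Q)
  2ΔQ≡2QΔ = solve-∀

theorem5p5 : (P Q : ℤ) (n : ℕ) (Q′ : ℤ) →
    Coprime n ∣ + 2 * (P * P - + 4 * Q) * Q ∣ →
    (+ n) ∣ (Q * Q′ - + 1) →
    StrongFrobeniusPSPQuad n (+ 2 - P * P * Q′) (+ 1) →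
    StrongLucasPSP P Q n
theorem5p5 P Q n Q′ n⊥2ΔQ QQ′≡1 (composite , n-odd , 1<n , n⊥Δf , F , frobenius , squareRoots) =
  let P⁻¹ , PP⁻¹≡1 = inverse-of-factor n P (P * Q′ * (P * P * Q′ - + 4))
                       (subst (λ m → Coprime n ∣ m ∣) (Δf-factorisation P Q′) n⊥Δf)
      Δ⁻¹ , ΔΔ⁻¹≡1 = inverse-of-factor n (P * P - + 4 * Q) (+ 2 * Q)
                       (subst (λ m → Coprime n ∣ m ∣) (2ΔQ-factorisation P Q) n⊥2ΔQ)
  in composite , subst (λ m → Coprime n ∣ m ∣) (2ΔQ≡2QΔ P Q) n⊥2ΔQ ,
     strong-lucas quadraticRing ι-homomorphism n 1<n n-odd n∣⇒ι≈0 ι≈0⇒n∣ P Q Q′ P⁻¹ Δ⁻¹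
       PP⁻¹≡1 (Signed.∣ᵤ⇒∣ QQ′≡1) ΔΔ⁻¹≡1 X X-root frobenius squareRoots
  where
  open QuadraticQuotient n (+ 2 - P * P * Q′)
  open StrongFrobeniusToLucas using (strong-lucas)
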